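{- Let $D_\circ\subset D'_\circ$ be two hollow dissections, identify $\mathbb{R}^{D_\circ}$ with the coordinate subspace of $\mathbb{R}^{D'_\circ}$ spanned by $\{\mathbf{e}_{\delta_\circ}:\delta_\circ\in D_\circ\}$, and let $\delta_\bullet$ be a $D'_\circ$-accordion diagonal. Then $\mathbf{g}(D'_\circ\mid\delta_\bullet)\in\mathbb{R}^{D_\circ}$ if and only if $\delta_\bullet$ is a $D_\circ$-accordion diagonal; moreover, in this case $\mathbf{g}(D_\circ\mid\delta_\bullet)=\mathbf{g}(D'_\circ\mid\delta_\bullet)$.
   Context: Fix $n\ge 2$ and $2n$ points on the unit circle of the (standardly oriented) Euclidean plane, labeled $1,\dots,2n$ clockwise. Odd points are hollow, even points solid; the hollow (resp. solid) polygon is their convex hull. A hollow (resp. solid) diagonal joins two hollow (resp. solid) points; polygon edges (boundary edges) count as diagonals, others are internal. Segments cross if they meet at a point interior to both. A hollow dissection is a set of pairwise non-crossing internal hollow diagonals; cells are closures of connected components of the hollow polygon minus its diagonals; $\overline{D}$ is $D$ plus all boundary edges. For a hollow dissection $D_\circ$, a solid diagonal is a $D_\circ$-accordion diagonal if the union of the segments of $\overline{D_\circ}$ it crosses is connected. Sign function: for a hollow dissection $R$, $r\in R$ and a solid diagonal $e$: $\zeta_R(r,e)=0$ if $e$ does not cross $r$; otherwise in each of the two cells of $R$ containing $r$, $e$ crosses exactly one other segment of $\overline R$, say $\mu,\nu$; if these are incident to distinct endpoints of $r$, write $r=uv,\mu=au,\nu=vb$ and $\zeta_R(r,e)=1$ if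 $a$ is strictly right of the directed line $u\to v$, $-1$ if strictly left; otherwise $0$. The $\mathbf{g}$-vector is $\mathbf{g}(D_\circ\mid\delta_\bullet)=\sum_{\delta_\circ\in D_\circ}\zeta_{D_\circ}(\delta_\circ,\delta_\bullet)\mathbf{e}_{\delta_\circ}\in\mathbb{R}^{D_\circ}$. -}

module Defs where

open import Data.Nat using (ℕ; zero; suc; _+_; _*_; _∸_; _≤_; _<_; _≡ᵇ_) renaming (_<ᵇ_ to ltᵇ)
open import Data.Nat.DivMod using (_%_)
open import Data.Bool using (Bool; true; false; _∧_; _∨_; not; if_then_else_)
open import Data.List using (List; []; _∷_; _++_; map; filterᵇ; foldr; upTo)
open import Data.List.Membership.Propositional using (_∈_)
open import Data.Product using (_×_; _,_; proj₁; proj₂)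
open import Data.Sum using (_⊎_)
open import Data.Integer using (ℤ; +_; -_)
open import Relation.Binary.PropositionalEquality using (_≡_)
open import Relation.Nullary using (¬_)

-- The 2n points are labelled 1,…,2n (natural
-- numbers) clockwise.  Everything about the geometry (crossing,
-- side of a directed line, cells) depends only on this cyclic order.
-- A segment/diagonal is a pair (a , b) of labels with a < b.

infix 8 _≺_
_≺_ : ℕ → ℕ → Bool
_≺_ = ltᵇ

Diag : Set
Diag = ℕ × ℕ

IsHollow : ℕ → ℕ → Set
IsHollow n p = (p % 2 ≡ 1) × (1 ≤ p) × (p ≤ 2 * n)

IsSolid : ℕ → ℕ → Set
IsSolid n p = (p % 2 ≡ 0) × (2 ≤ p) × (p ≤ 2 * n)

HollowDiag : ℕ → Diag → Set
HollowDiag n (a , b) = IsHollow n a × IsHollow n b × (a < b)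

SolidDiag : ℕ → Diag → Set
SolidDiag n (a , b) = IsSolid n a × IsSolid n b × (a < b)

IsHollowBoundary : ℕ → Diag → Set
IsHollowBoundary n (a , b) = (b ≡ a + 2) ⊎ ((a ≡ 1) × (b ≡ 2 * n ∸ 1))

InternalHollowDiag : ℕ → Diag → Set
InternalHollowDiag n d = HollowDiag n d × ¬ IsHollowBoundary n d

-- two chords of the circle cross (meet at a point interior to both)
-- iff their endpoints interleave
Cross : Diag → Diag → Set
Cross (a , b) (c , d) = ((a < c) × (c < b) × (b < d)) ⊎ ((c < a) × (a < d) × (d < b))

crossᵇ : Diag → Diag → Bool
crossᵇ (a , b) (c , d) = (a ≺ c ∧ c ≺ b ∧ b ≺ d) ∨ (c ≺ a ∧ a ≺ d ∧ d ≺ b)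

-- a hollow dissection, given as a finite list (read as a set)
HollowDissection : ℕ → List Diag → Set
HollowDissection n D =
  (∀ d → d ∈ D → InternalHollowDiag n d) ×
  (∀ d d' → d ∈ D → d' ∈ D → ¬ Cross d d')

hollowBoundary : ℕ → List Diag
hollowBoundary n = (1 , 2 * n ∸ 1) ∷ map (λ i → (2 * i + 1 , 2 * i + 3)) (upTo (n ∸ 1))

closure : ℕ → List Diag → List Diag
closure n D = D ++ hollowBoundary n

-- Accordion diagonals.  The segments of D̄ pairwise meet only at common
-- endpoints, so the union of a family of them is connected iff the
-- "share an endpoint" graph on the family is connected.

ShareEnd : Diag → Diag → Set
ShareEnd (a , b) (c , d) = (a ≡ c) ⊎ (a ≡ d) ⊎ (b ≡ c) ⊎ (b ≡ d)

data Chain (P : Diag → Set) : Diag → Diag → Set where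
  here : ∀ {s} → P s → Chain P s s
  step : ∀ {s t u} → P s → ShareEnd s t → Chain P t u → Chain P s u

CrossedBy : ℕ → List Diag → Diag → Diag → Set
CrossedBy n D e s = (s ∈ closure n D) × Cross s e

IsAccordion : ℕ → List Diag → Diag → Set
IsAccordion n D e =
  ∀ s t → CrossedBy n D e s → CrossedBy n D e t → Chain (CrossedBy n D e) s t

hollowPoints : ℕ → List ℕ
hollowPoints n = map (λ i → 2 * i + 1) (upTo n)

separatesᵇ : Diag → ℕ → ℕ → Bool
separatesᵇ (c , d) x y = (ins x ∧ outs y) ∨ (outs x ∧ ins y)
  where
  ins : ℕ → Bool
  ins z = c ≺ z ∧ z ≺ d
  outs : ℕ → Bool
  outs z = z ≺ c ∨ d ≺ z

allᵇ : (Diag → Bool) → List Diag → Bool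
allᵇ p = foldr (λ d b → p d ∧ b) true

unseparatedᵇ : List Diag → ℕ → ℕ → ℕ → Bool
unseparatedᵇ R u v x = allᵇ (λ d → not (separatesᵇ d x u) ∧ not (separatesᵇ d x v)) R

-- For r = (u , v) ∈ R (u < v), the vertices (other than u, v) of the
-- cell of R containing r on the side of the arc u < x < v,
-- listed in clockwise order from u to v.
cellA : ℕ → List Diag → ℕ → ℕ → List ℕ
cellA n R u v = filterᵇ (λ x → u ≺ x ∧ x ≺ v ∧ unseparatedᵇ R u v x) (hollowPoints n)

-- Same for the other cell containing r (the side of the complementary
-- arc), listed in clockwise order from v to u.
cellB : ℕ → List Diag → ℕ → ℕ → List ℕ
cellB n R u v =
  filterᵇ (λ x → v ≺ x ∧ unseparatedᵇ R u v x) (hollowPoints n) ++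
  filterᵇ (λ x → x ≺ u ∧ unseparatedᵇ R u v x) (hollowPoints n)

firstOr : List ℕ → ℕ
firstOr []      = 0
firstOr (x ∷ _) = x

lastOr : List ℕ → ℕ
lastOr []           = 0
lastOr (x ∷ [])     = x
lastOr (_ ∷ y ∷ ys) = lastOr (y ∷ ys)

seg : ℕ → ℕ → Diag
seg a b = if a ≺ b then (a , b) else (b , a)

-- a strictly right of the directed line u → v: with clockwise labels on
-- the circle this holds iff u, v, a are in clockwise cyclic order
rightOfᵇ : ℕ → ℕ → ℕ → Bool
rightOfᵇ u v a = (u ≺ v ∧ v ≺ a) ∨ (v ≺ a ∧ a ≺ u) ∨ (a ≺ u ∧ u ≺ v)

leftOfᵇ : ℕ → ℕ → ℕ → Bool
leftOfᵇ u v a = rightOfᵇ v u a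

signAt : ℕ → ℕ → ℕ → ℤ
signAt u v a =
  if rightOfᵇ u v a then + 1 else (if leftOfᵇ u v a then - (+ 1) else + 0)

-- In the cell on side A the segments of R̄ other than r
-- that are incident to u resp. v are (u, firstOr A) resp. (lastOr A, v);
-- in the cell on side B they are (lastOr B, u) resp. (v, firstOr B).
-- The segment μ (resp. ν) crossed by e in the cell is incident to u
-- (resp. v) iff e crosses the corresponding one of these.
ζ : ℕ → List Diag → Diag → Diag → ℤ
ζ n R (u , v) e =
  if not (crossᵇ (u , v) e) then + 0 else
  (if crossᵇ (seg u a₁) e ∧ crossᵇ (seg v b₁) e then signAt u v a₁ else
  (if crossᵇ (seg ak v) e ∧ crossᵇ (seg bk u) e then signAt v u ak else + 0))
  where
  a₁ = firstOr (cellA n R u v)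
  ak = lastOr (cellA n R u v)
  b₁ = firstOr (cellB n R u v)
  bk = lastOr (cellB n R u v)

-- The g-vector g(R | e) ∈ ℝ^R: its coordinate at r ∈ R is ζ_R(r, e)
-- (coefficients are integers, so they are recorded in ℤ).  Only the
-- coordinates r ∈ R are meaningful.
gvec : ℕ → List Diag → Diag → Diag → ℤ
gvec n R e r = ζ n R r e

InCoordSubspace : List Diag → List Diag → (Diag → ℤ) → Set
InCoordSubspace D D' v = ∀ r → r ∈ D' → ¬ (r ∈ D) → v r ≡ + 0

_⊆D_ : List Diag → List Diag → Set
D ⊆D D' = ∀ d → d ∈ D → d ∈ D'

{-# OPTIONS --safe #-}
module Submission where

-- Let r = uv ∈ R be crossed by δ; call A the side of r containing the arc from u to v
-- and B the other side.  On each side δ leaves the cell of R at r through a segment of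
-- R̄ incident to u or to v (its exit), and ζ_R(r, δ) ≠ 0 exactly when the exits on the
-- two sides are at different endpoints of r.  The crossed boundary edges next to the
-- endpoints of δ lie on opposite sides of r, so if R is a δ-accordion the chain of
-- crossed segments joining them passes from side A to side B, either through r or
-- through two segments meeting at an endpoint of r; the latter are exits at the same
-- endpoint.  Hence for r ∈ D' ∖ D the D-chain avoids r and ζ_{D'}(r, δ) = 0.
-- Conversely, if ζ_{D'}(r, δ) = 0 the two neighbours of r in a D'-chain meet at a
-- common endpoint, so every r ∈ D' ∖ D can be cut out of the chain.  Finally, for
-- r ∈ D crossed segments of D̄ stay crossed in D̄' and the exit on each side of r is
-- unique in D̄', so D and D' have the same exits at r and the same ζ.

open import Defs
open import Data.Nat using (ℕ; suc; _+_; _*_; _∸_; _≤_; _<_; _≤?_; _<?_; _≟_; s≤s; z≤n)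
open import Data.Nat.Properties
open import Data.Nat.DivMod using (_%_; _/_; [m+kn]%n≡m%n; m*n%n≡0; m≡m%n+[m/n]*n)
open import Data.Bool using (Bool; true; false; T; not; _∧_; _∨_; if_then_else_)
open import Data.Bool.Properties using (T-≡; T-∧; T-∨)
open import Data.Empty using (⊥; ⊥-elim)
open import Data.Unit using (tt)
open import Data.Integer using (ℤ; +_; -_)
open import Data.Product using (∃-syntax; _×_; _,_; proj₁; proj₂)
open import Data.Product.Function.NonDependent.Propositional using (_×-⇔_)
open import Data.Product.Properties using (≡-dec)
open import Data.Sum using (_⊎_; inj₁; inj₂; [_,_]′)
import Data.Sum as Sum
open import Data.Sum.Function.Propositional using (_⊎-⇔_)
open import Data.List using (List; []; _∷_; map; upTo; filterᵇ)
open import Data.List.Membership.Propositional using (_∈_)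
open import Data.List.Membership.Propositional.Properties
  using (∈-map⁺; ∈-map⁻; ∈-upTo⁺; ∈-upTo⁻; ∈-filter⁺; ∈-filter⁻; ∈-++⁺ˡ; ∈-++⁺ʳ; ∈-++⁻)
open import Data.List.Relation.Unary.Any using (here; there)
open import Function using (_∘_; id; flip; _⇔_; mk⇔; Equivalence)
open import Function.Construct.Symmetry using (⇔-sym)
open import Function.Construct.Composition using (_⇔-∘_)
open import Relation.Binary.Definitions using (tri<; tri≈; tri>)
open import Relation.Binary.PropositionalEquality
open import Relation.Nullary using (Dec; yes; no; ¬_)
open import Relation.Nullary.Decidable using (T?; _×-dec_; _⊎-dec_; ¬?; map′)
open import Relation.Unary using (Decidable)

infixr 9 _⟫_
_⟫_ : ∀ {a b c} → a < b → b < c → a < c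
_⟫_ = <-trans

T⇒≡true : ∀ {b} → T b → b ≡ true
T⇒≡true = Equivalence.to T-≡

¬T⇒≡false : ∀ {b} → ¬ T b → b ≡ false
¬T⇒≡false {false} _ = refl
¬T⇒≡false {true} ¬t = ⊥-elim (¬t tt)

T-not⁻ : ∀ {b} → T (not b) → ¬ T b
T-not⁻ {false} _ ()

T-not⁺ : ∀ {b} → ¬ T b → T (not b)
T-not⁺ {true} ¬t = ¬t tt
T-not⁺ {false} _ = tt

T-⇔⇒≡ : ∀ {a b} → T a ⇔ T b → a ≡ b
T-⇔⇒≡ {true} {true} _ = refl
T-⇔⇒≡ {false} {false} _ = refl
T-⇔⇒≡ {true} {false} a⇔b = ⊥-elim (Equivalence.to a⇔b tt)
T-⇔⇒≡ {false} {true} a⇔b = ⊥-elim (Equivalence.from a⇔b tt)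

T-≺ : ∀ {m n} → T (m ≺ n) ⇔ m < n
T-≺ = mk⇔ (<ᵇ⇒< _ _) <⇒<ᵇ

<⇒≺≡true : ∀ {m n} → m < n → m ≺ n ≡ true
<⇒≺≡true = T⇒≡true ∘ <⇒<ᵇ

≮⇒≺≡false : ∀ {m n} → ¬ m < n → m ≺ n ≡ false
≮⇒≺≡false m≮n = ¬T⇒≡false (m≮n ∘ <ᵇ⇒< _ _)

T-crossᵇ : ∀ s e → T (crossᵇ s e) ⇔ Cross s e
T-crossᵇ (a , b) (c , d) = (chain ⊎-⇔ chain) ⇔-∘ T-∨
  where
  chain : ∀ {w x y z} → T (w ≺ x ∧ x ≺ y ∧ y ≺ z) ⇔ (w < x × x < y × y < z)
  chain = (T-≺ ×-⇔ ((T-≺ ×-⇔ T-≺) ⇔-∘ T-∧)) ⇔-∘ T-∧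

Cross? : ∀ s e → Dec (Cross s e)
Cross? s e = map′ (Equivalence.to (T-crossᵇ s e)) (Equivalence.from (T-crossᵇ s e)) (T? (crossᵇ s e))

Cross-sym : ∀ {s t} → Cross s t → Cross t s
Cross-sym {_ , _} {_ , _} (inj₁ x) = inj₂ x
Cross-sym {_ , _} {_ , _} (inj₂ y) = inj₁ y

seg-< : ∀ {x y} → x < y → seg x y ≡ (x , y)
seg-< x<y rewrite <⇒≺≡true x<y = refl

seg-> : ∀ {x y} → y < x → seg x y ≡ (y , x)
seg-> y<x rewrite ≮⇒≺≡false (<-asym y<x) = refl

Inside Outside : Diag → ℕ → Set
Inside (c , d) z = c < z × z < d
Outside (c , d) z = z < c ⊎ d < z

Separates : Diag → ℕ → ℕ → Set
Separates s x y = (Inside s x × Outside s y) ⊎ (Outside s x × Inside s y)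

T-separatesᵇ : ∀ s x y → T (separatesᵇ s x y) ⇔ Separates s x y
T-separatesᵇ (c , d) x y =
  ((inside ×-⇔ outside) ⊎-⇔ (outside ×-⇔ inside)) ⇔-∘ ((T-∧ ⊎-⇔ T-∧) ⇔-∘ T-∨)
  where
  inside : ∀ {z} → T (c ≺ z ∧ z ≺ d) ⇔ Inside (c , d) z
  inside = (T-≺ ×-⇔ T-≺) ⇔-∘ T-∧
  outside : ∀ {z} → T (z ≺ c ∨ d ≺ z) ⇔ Outside (c , d) z
  outside = (T-≺ ⊎-⇔ T-≺) ⇔-∘ T-∨

T-allᵇ : ∀ {p : Diag → Bool} L → T (allᵇ p L) ⇔ (∀ d → d ∈ L → T (p d))
T-allᵇ {p} L = mk⇔ (to L) (from L)
  where
  to : ∀ L → T (allᵇ p L) → ∀ d → d ∈ L → T (p d)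
  to (x ∷ L) t d (here refl) = proj₁ (Equivalence.to T-∧ t)
  to (x ∷ L) t d (there d∈L) = to L (proj₂ (Equivalence.to (T-∧ {p x}) t)) d d∈L
  from : ∀ L → (∀ d → d ∈ L → T (p d)) → T (allᵇ p L)
  from [] _ = tt
  from (x ∷ L) all = Equivalence.from T-∧ (all x (here refl) , from L (λ d → all d ∘ there))

Unseparated : List Diag → ℕ → ℕ → ℕ → Set
Unseparated R u v x = ∀ s → s ∈ R → ¬ Separates s x u × ¬ Separates s x v

T-unseparatedᵇ : ∀ R u v x → T (unseparatedᵇ R u v x) ⇔ Unseparated R u v x
T-unseparatedᵇ R u v x = mk⇔ to from
  where
  test : Diag → Bool
  test s = not (separatesᵇ s x u) ∧ not (separatesᵇ s x v)
  to : T (unseparatedᵇ R u v x) → Unseparated R u v x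
  to t s s∈R with Equivalence.to (T-∧ {not (separatesᵇ s x u)}) (Equivalence.to (T-allᵇ R) t s s∈R)
  ... | nu , nv = T-not⁻ nu ∘ Equivalence.from (T-separatesᵇ s x u) ,
                  T-not⁻ nv ∘ Equivalence.from (T-separatesᵇ s x v)
  from : Unseparated R u v x → T (unseparatedᵇ R u v x)
  from un = Equivalence.from (T-allᵇ {test} R) λ s s∈R →
    Equivalence.from T-∧ (T-not⁺ (proj₁ (un s s∈R) ∘ Equivalence.to (T-separatesᵇ s x u)) ,
                          T-not⁺ (proj₂ (un s s∈R) ∘ Equivalence.to (T-separatesᵇ s x v)))

record Odd (x : ℕ) : Set where
  constructor odd
  field odd-% : x % 2 ≡ 1

record Even (x : ℕ) : Set where
  constructor even
  field even-% : x % 2 ≡ 0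

odd-view : ∀ {x} → Odd x → x ≡ suc (x / 2 * 2)
odd-view {x} (odd x%2) = trans (m≡m%n+[m/n]*n x 2) (cong (_+ x / 2 * 2) x%2)

even-view : ∀ {x} → Even x → x ≡ x / 2 * 2
even-view {x} (even x%2) = trans (m≡m%n+[m/n]*n x 2) (cong (_+ x / 2 * 2) x%2)

Odd-1+k*2 : ∀ k → Odd (suc (k * 2))
Odd-1+k*2 k = odd ([m+kn]%n≡m%n 1 k 2)

Even-k*2 : ∀ k → Even (k * 2)
Even-k*2 k = even (m*n%n≡0 k 2)

Even-2* : ∀ n → Even (2 * n)
Even-2* n rewrite *-comm 2 n = Even-k*2 n

odd≢even : ∀ {x y} → Odd x → Even y → x ≢ y
odd≢even (odd x%2) (even y%2) refl with trans (sym x%2) y%2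
... | ()

Odd⇒Even-suc : ∀ {x} → Odd x → Even (suc x)
Odd⇒Even-suc {x} o = subst (Even ∘ suc) (sym (odd-view o)) (Even-k*2 (suc (x / 2)))

Even⇒Odd-suc : ∀ {x} → Even x → Odd (suc x)
Even⇒Odd-suc {x} e = subst (Odd ∘ suc) (sym (even-view e)) (Odd-1+k*2 (x / 2))

Even-suc⇒Odd : ∀ {x} → Even (suc x) → Odd x
Even-suc⇒Odd {x} e with suc x / 2 | even-view e
... | suc k | x≡ = subst Odd (sym (suc-injective x≡)) (Odd-1+k*2 k)

Odd⇒1≤ : ∀ {x} → Odd x → 1 ≤ x
Odd⇒1≤ {suc x} _ = s≤s z≤n

odd-gap : ∀ {x y} → Odd x → Odd y → x < y → suc x < y
odd-gap ox oy x<y = ≤∧≢⇒< x<y (λ eq → odd≢even oy (Odd⇒Even-suc ox) (sym eq))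

even-gap : ∀ {x y} → Even x → Even y → x < y → suc x < y
even-gap ex ey x<y = ≤∧≢⇒< x<y (odd≢even (Even⇒Odd-suc ex) ey)

¬odd-between : ∀ {x z} → Odd x → Odd z → x < z → z < suc (suc x) → ⊥
¬odd-between ox oz x<z z<x+2 = <⇒≱ z<x+2 (odd-gap ox oz x<z)

Even-pred : ∀ {x} → Even x → 1 ≤ x → Odd (x ∸ 1) × suc (x ∸ 1) ≡ x
Even-pred {suc x} e _ = Even-suc⇒Odd e , refl

<⇒≤∸1 : ∀ {a b} → a < b → a ≤ b ∸ 1
<⇒≤∸1 {b = suc b} (s≤s a≤b) = a≤b

-- Hollow points and boundary edges

IsHollow⇒Odd : ∀ {n x} → IsHollow n x → Odd x
IsHollow⇒Odd (x%2 , _) = odd x%2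

IsHollow⇒<2n : ∀ {n x} → IsHollow n x → x < 2 * n
IsHollow⇒<2n {n} (x%2 , _ , x≤2n) = ≤∧≢⇒< x≤2n (odd≢even (odd x%2) (Even-2* n))

IsHollow⇒≤2n-1 : ∀ {n x} → IsHollow n x → x ≤ 2 * n ∸ 1
IsHollow⇒≤2n-1 {n} = <⇒≤∸1 ∘ IsHollow⇒<2n {n}

2*i+1≡ : ∀ i → 2 * i + 1 ≡ suc (i * 2)
2*i+1≡ i = trans (+-comm (2 * i) 1) (cong suc (*-comm 2 i))

2*i+3≡ : ∀ i → 2 * i + 3 ≡ suc (suc (suc (i * 2)))
2*i+3≡ i = trans (+-comm (2 * i) 3) (cong (suc ∘ suc ∘ suc) (*-comm 2 i))

∈-hollowPoints⁻ : ∀ {n x} → x ∈ hollowPoints n → IsHollow n x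
∈-hollowPoints⁻ {n} x∈ with ∈-map⁻ (λ i → 2 * i + 1) x∈
... | i , i∈ , refl rewrite 2*i+1≡ i = Odd.odd-% (Odd-1+k*2 i) , s≤s z≤n , x≤2n
  where
  x≤2n : suc (i * 2) ≤ 2 * n
  x≤2n = subst (suc (i * 2) ≤_) (*-comm n 2) (≤-trans (n≤1+n _) (*-monoˡ-≤ 2 (∈-upTo⁻ i∈)))

∈-hollowPoints⁺ : ∀ {n x} → IsHollow n x → x ∈ hollowPoints n
∈-hollowPoints⁺ {n} {x} (x%2 , _ , x≤2n) =
  subst (_∈ hollowPoints n) (trans (2*i+1≡ k) (sym x≡))
        (∈-map⁺ (λ i → 2 * i + 1) (∈-upTo⁺ (*-cancelʳ-< 2 k n k*2<n*2)))
  where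
  k : ℕ
  k = x / 2
  x≡ : x ≡ suc (k * 2)
  x≡ = odd-view (odd x%2)
  k*2<n*2 : k * 2 < n * 2
  k*2<n*2 = <-≤-trans (subst (k * 2 <_) (sym x≡) (n<1+n _)) (subst (x ≤_) (*-comm 2 n) x≤2n)

∈-hollowBoundary⁻ : ∀ {n s} → s ∈ hollowBoundary n →
  s ≡ (1 , 2 * n ∸ 1) ⊎ ∃[ x ] Odd x × suc (suc x) < 2 * n × s ≡ (x , suc (suc x))
∈-hollowBoundary⁻ (here refl) = inj₁ refl
∈-hollowBoundary⁻ {n} (there s∈) with ∈-map⁻ (λ i → (2 * i + 1 , 2 * i + 3)) s∈
... | i , i∈ , refl = inj₂ (suc (i * 2) , Odd-1+k*2 i , x+2<2n , cong₂ _,_ (2*i+1≡ i) (2*i+3≡ i))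
  where
  x+2<2n : suc (suc (suc (i * 2))) < 2 * n
  x+2<2n = subst (suc (suc (suc (suc (i * 2)))) ≤_) (*-comm n 2)
             (*-monoˡ-≤ 2 (m<n∸1⇒2+m≤n {n = n} (∈-upTo⁻ i∈)))
    where
    m<n∸1⇒2+m≤n : ∀ {i n} → i < n ∸ 1 → suc (suc i) ≤ n
    m<n∸1⇒2+m≤n {n = suc n} i<n = s≤s i<n

∈-hollowBoundary⁺ : ∀ {n x} → Odd x → suc (suc x) < 2 * n → (x , suc (suc x)) ∈ hollowBoundary n
∈-hollowBoundary⁺ {n} {x} o x+2<2n =
  there (subst (_∈ map edge (upTo (n ∸ 1))) edge-k≡ (∈-map⁺ edge (∈-upTo⁺ k<n∸1)))
  where
  edge : ℕ → Diag
  edge i = (2 * i + 1 , 2 * i + 3)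
  k : ℕ
  k = x / 2
  x≡ : x ≡ suc (k * 2)
  x≡ = odd-view o
  edge-k≡ : edge k ≡ (x , suc (suc x))
  edge-k≡ = cong₂ _,_ (trans (2*i+1≡ k) (sym x≡)) (trans (2*i+3≡ k) (cong (suc ∘ suc) (sym x≡)))
  2+k≤n : suc (suc k) ≤ n
  2+k≤n = *-cancelʳ-≤ (suc (suc k)) n 2
            (subst₂ (λ a b → suc (suc a) < b) x≡ (*-comm 2 n) x+2<2n)
  k<n∸1 : k < n ∸ 1
  k<n∸1 = <⇒≤∸1 2+k≤n

∈-hollowBoundary⇒IsHollowBoundary : ∀ {n s} → s ∈ hollowBoundary n → IsHollowBoundary n s
∈-hollowBoundary⇒IsHollowBoundary {n} s∈ with ∈-hollowBoundary⁻ {n} s∈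
... | inj₁ refl = inj₂ (refl , refl)
... | inj₂ (x , _ , _ , refl) = inj₁ (+-comm 2 x)

boundary-¬Cross : ∀ {n s c d} → s ∈ hollowBoundary n → IsHollow n c → IsHollow n d → ¬ Cross s (c , d)
boundary-¬Cross {n} s∈ hc hd with ∈-hollowBoundary⁻ {n} s∈
... | inj₁ refl = λ where
  (inj₁ (_ , _ , 2n-1<d)) → <⇒≱ 2n-1<d (IsHollow⇒≤2n-1 {n} hd)
  (inj₂ (c<1 , _ , _)) → <⇒≱ c<1 (proj₁ (proj₂ hc))
... | inj₂ (x , ox , _ , refl) = λ where
  (inj₁ (x<c , c<x+2 , _)) → ¬odd-between ox (IsHollow⇒Odd {n} hc) x<c c<x+2
  (inj₂ (_ , x<d , d<x+2)) → ¬odd-between ox (IsHollow⇒Odd {n} hd) x<d d<x+2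

hollow-¬Outside : ∀ {n z} → IsHollow n z → ¬ Outside (1 , 2 * n ∸ 1) z
hollow-¬Outside {n} hz (inj₁ z<1) = <⇒≱ z<1 (proj₁ (proj₂ hz))
hollow-¬Outside {n} hz (inj₂ 2n-1<z) = <⇒≱ 2n-1<z (IsHollow⇒≤2n-1 {n} hz)

boundary-¬Separates : ∀ {n s x y} → s ∈ hollowBoundary n → IsHollow n x → IsHollow n y → ¬ Separates s x y
boundary-¬Separates {n} s∈ hx hy with ∈-hollowBoundary⁻ {n} s∈
... | inj₁ refl = λ where
  (inj₁ (_ , out)) → hollow-¬Outside {n} hy out
  (inj₂ (out , _)) → hollow-¬Outside {n} hx out
... | inj₂ (a , oa , _ , refl) = λ where
  (inj₁ ((a<x , x<a+2) , _)) → ¬odd-between oa (IsHollow⇒Odd {n} hx) a<x x<a+2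
  (inj₂ (_ , (a<y , y<a+2))) → ¬odd-between oa (IsHollow⇒Odd {n} hy) a<y y<a+2

edge-around : ∀ {n x} → Even x → 1 ≤ x → x < 2 * n → (x ∸ 1 , suc x) ∈ hollowBoundary n
edge-around {n} {x} ex 1≤x x<2n with Even-pred ex 1≤x
... | ox , suc[x∸1]≡x =
      subst (λ y → (x ∸ 1 , suc y) ∈ hollowBoundary n) suc[x∸1]≡x
        (∈-hollowBoundary⁺ {n} ox (subst (λ y → suc y < 2 * n) (sym suc[x∸1]≡x) (even-gap ex (Even-2* n) x<2n)))

module Polygon (n : ℕ) (2≤n : 2 ≤ n) where

  2<2n : 2 < 2 * n
  2<2n = ≤-trans (s≤s (s≤s (s≤s z≤n))) (*-monoʳ-≤ 2 2≤n)

  1≤2n : 1 ≤ 2 * n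
  1≤2n = <⇒≤ (≤-<-trans (s≤s z≤n) 2<2n)

  1-hollow : IsHollow n 1
  1-hollow = refl , ≤-refl , 1≤2n

  2n-1-odd : Odd (2 * n ∸ 1)
  2n-1-odd = proj₁ (Even-pred (Even-2* n) 1≤2n)

  2n-1<2n : 2 * n ∸ 1 < 2 * n
  2n-1<2n = subst (2 * n ∸ 1 <_) (proj₂ (Even-pred (Even-2* n) 1≤2n)) ≤-refl

  1<2n-1 : 1 < 2 * n ∸ 1
  1<2n-1 = <⇒≤∸1 2<2n

  2n-1-hollow : IsHollow n (2 * n ∸ 1)
  2n-1-hollow = Odd.odd-% 2n-1-odd , <⇒≤ 1<2n-1 , m∸n≤m (2 * n) 1

  boundary-hollow : ∀ {s} → s ∈ hollowBoundary n → HollowDiag n s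
  boundary-hollow s∈ with ∈-hollowBoundary⁻ {n} s∈
  ... | inj₁ refl = 1-hollow , 2n-1-hollow , 1<2n-1
  ... | inj₂ (x , ox , x+2<2n , refl) =
        (Odd.odd-% ox , Odd⇒1≤ ox , <⇒≤ (n<1+n x ⟫ n<1+n _ ⟫ x+2<2n)) ,
        (Odd.odd-% (Even⇒Odd-suc (Odd⇒Even-suc ox)) , s≤s z≤n , <⇒≤ x+2<2n) ,
        n<1+n x ⟫ n<1+n _

T-≺∧unseparatedᵇ : ∀ {a b} R u v x → T (a ≺ b ∧ unseparatedᵇ R u v x) ⇔ (a < b × Unseparated R u v x)
T-≺∧unseparatedᵇ R u v x = (T-≺ ×-⇔ T-unseparatedᵇ R u v x) ⇔-∘ T-∧

T-cellA-test : ∀ R u v x → T (u ≺ x ∧ x ≺ v ∧ unseparatedᵇ R u v x) ⇔ (u < x × x < v × Unseparated R u v x)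
T-cellA-test R u v x = (T-≺ ×-⇔ T-≺∧unseparatedᵇ R u v x) ⇔-∘ T-∧

∈-cellA⁻ : ∀ {n R u v x} → x ∈ cellA n R u v → IsHollow n x × u < x × x < v × Unseparated R u v x
∈-cellA⁻ {n} {R} {u} {v} {x} x∈ with ∈-filter⁻ (T? ∘ λ y → u ≺ y ∧ y ≺ v ∧ unseparatedᵇ R u v y) {xs = hollowPoints n} x∈
... | x∈hp , t = ∈-hollowPoints⁻ {n} x∈hp ,
                 Equivalence.to (T-cellA-test R u v x) t

∈-cellA⁺ : ∀ {n R u v x} → IsHollow n x → u < x → x < v → Unseparated R u v x → x ∈ cellA n R u v
∈-cellA⁺ {n} {R} {u} {v} {x} hx u<x x<v un =
  ∈-filter⁺ (T? ∘ λ y → u ≺ y ∧ y ≺ v ∧ unseparatedᵇ R u v y) (∈-hollowPoints⁺ {n} hx)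
    (Equivalence.from (T-cellA-test R u v x) (u<x , x<v , un))

∈-cellB⁻ : ∀ {n R u v x} → x ∈ cellB n R u v → IsHollow n x × Outside (u , v) x × Unseparated R u v x
∈-cellB⁻ {n} {R} {u} {v} {x} x∈ with ∈-++⁻ (filterᵇ (λ y → v ≺ y ∧ unseparatedᵇ R u v y) (hollowPoints n)) x∈
... | inj₁ x∈₁ with ∈-filter⁻ (T? ∘ λ y → v ≺ y ∧ unseparatedᵇ R u v y) {xs = hollowPoints n} x∈₁
...   | x∈hp , t with Equivalence.to (T-≺∧unseparatedᵇ R u v x) t
...     | v<x , un = ∈-hollowPoints⁻ {n} x∈hp , inj₂ v<x , un
∈-cellB⁻ {n} {R} {u} {v} {x} x∈ | inj₂ x∈₂ with ∈-filter⁻ (T? ∘ λ y → y ≺ u ∧ unseparatedᵇ R u v y) {xs = hollowPoints n} x∈₂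
...   | x∈hp , t with Equivalence.to (T-≺∧unseparatedᵇ R u v x) t
...     | x<u , un = ∈-hollowPoints⁻ {n} x∈hp , inj₁ x<u , un

∈-cellB⁺ : ∀ {n R u v x} → IsHollow n x → Outside (u , v) x → Unseparated R u v x → x ∈ cellB n R u v
∈-cellB⁺ {n} {R} {u} {v} {x} hx (inj₁ x<u) un =
  ∈-++⁺ʳ (filterᵇ (λ y → v ≺ y ∧ unseparatedᵇ R u v y) (hollowPoints n))
    (∈-filter⁺ (T? ∘ λ y → y ≺ u ∧ unseparatedᵇ R u v y) (∈-hollowPoints⁺ {n} hx)
      (Equivalence.from (T-≺∧unseparatedᵇ R u v x) (x<u , un)))
∈-cellB⁺ {n} {R} {u} {v} {x} hx (inj₂ v<x) un =
  ∈-++⁺ˡ (∈-filter⁺ (T? ∘ λ y → v ≺ y ∧ unseparatedᵇ R u v y) (∈-hollowPoints⁺ {n} hx)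
    (Equivalence.from (T-≺∧unseparatedᵇ R u v x) (v<x , un)))

firstOr-∈ : ∀ {xs : List ℕ} {x} → x ∈ xs → firstOr xs ∈ xs
firstOr-∈ {_ ∷ _} _ = here refl

lastOr-∈ : ∀ {xs : List ℕ} {x} → x ∈ xs → lastOr xs ∈ xs
lastOr-∈ {_ ∷ []} _ = here refl
lastOr-∈ {_ ∷ y ∷ ys} _ = there (lastOr-∈ {y ∷ ys} (here refl))

maximum-where : ∀ {A : Set} (P : A → Set) → Decidable P → (f : A → ℕ) (L : List A) →
  (∃[ y ] y ∈ L × P y × (∀ z → z ∈ L → P z → f z ≤ f y)) ⊎ (∀ z → z ∈ L → ¬ P z)
maximum-where P P? f [] = inj₂ λ _ ()
maximum-where P P? f (a ∷ L) with P? a | maximum-where P P? f L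
... | no ¬pa | inj₂ none = inj₂ λ where
  _ (here refl) → ¬pa
  z (there z∈) → none z z∈
... | no ¬pa | inj₁ (y , y∈ , py , max) = inj₁ (y , there y∈ , py , λ where
  _ (here refl) pz → ⊥-elim (¬pa pz)
  z (there z∈) → max z z∈)
... | yes pa | inj₂ none = inj₁ (a , here refl , pa , λ where
  _ (here refl) _ → ≤-refl
  z (there z∈) pz → ⊥-elim (none z z∈ pz))
... | yes pa | inj₁ (y , y∈ , py , max) with f a ≤? f y
...   | yes fa≤fy = inj₁ (y , there y∈ , py , λ where
  _ (here refl) _ → fa≤fy
  z (there z∈) → max z z∈)
...   | no fa≰fy = inj₁ (a , here refl , pa , λ where
  _ (here refl) _ → ≤-refl
  z (there z∈) pz → ≤-trans (max z z∈ pz) (<⇒≤ (≰⇒> fa≰fy)))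

-- Chains of segments

_≟D_ : (x y : Diag) → Dec (x ≡ y)
_≟D_ = ≡-dec _≟_ _≟_

open import Data.List.Membership.DecPropositional _≟D_ using (_∈?_)

ShareEnd-sym : ∀ {x y} → ShareEnd x y → ShareEnd y x
ShareEnd-sym (inj₁ refl) = inj₁ refl
ShareEnd-sym (inj₂ (inj₁ refl)) = inj₂ (inj₂ (inj₁ refl))
ShareEnd-sym (inj₂ (inj₂ (inj₁ refl))) = inj₂ (inj₁ refl)
ShareEnd-sym (inj₂ (inj₂ (inj₂ refl))) = inj₂ (inj₂ (inj₂ refl))

Incident : ℕ → Diag → Set
Incident w (c , d) = c ≡ w ⊎ d ≡ w

Incident⇒ShareEnd : ∀ {w s t} → Incident w s → Incident w t → ShareEnd s t
Incident⇒ShareEnd (inj₁ refl) (inj₁ refl) = inj₁ refl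
Incident⇒ShareEnd (inj₁ refl) (inj₂ refl) = inj₂ (inj₁ refl)
Incident⇒ShareEnd (inj₂ refl) (inj₁ refl) = inj₂ (inj₂ (inj₁ refl))
Incident⇒ShareEnd (inj₂ refl) (inj₂ refl) = inj₂ (inj₂ (inj₂ refl))

Chain-head : ∀ {P s t} → Chain P s t → P s
Chain-head (here ps) = ps
Chain-head (step ps _ _) = ps

Chain-exit : ∀ {P Q : Diag → Set} {s t} → Decidable Q → Chain P s t → Q s → ¬ Q t →
             ∃[ x ] ∃[ y ] P x × P y × Q x × ¬ Q y × ShareEnd x y
Chain-exit Q? (here _) qs ¬qt = ⊥-elim (¬qt qs)
Chain-exit {s = s} Q? (step {t = x} ps s~x c) qs ¬qt with Q? x
... | yes qx = Chain-exit Q? c qx ¬qt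
... | no ¬qx = s , x , ps , Chain-head c , qs , ¬qx , s~x

Bypassable : (Diag → Set) → Diag → Set
Bypassable P x = ∀ {y z} → P y → P z → y ≢ x → z ≢ x → ShareEnd y x → ShareEnd x z → ShareEnd y z

Chain-shortcut : ∀ {P P' : Diag → Set} → (∀ {x} → P x → P' x) → Decidable P →
                 (∀ {x} → P' x → ¬ P x → Bypassable P' x) →
                 ∀ {s t} → Chain P' s t → P s → P t → Chain P s t
Chain-shortcut {P} {P'} P⊆P' P? bypass c ps pt = proj₁ (go c pt) ps
  where
  go : ∀ {s t} → Chain P' s t → P t →
       (P s → Chain P s t) × (¬ P s → ∀ {y} → P y → ShareEnd y s → Chain P y t)
  go (here _) pt = (λ _ → here pt) , (λ ¬ps _ _ → ⊥-elim (¬ps pt))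
  go {s} {t} (step {t = x} p's s~x c) pt = from-P , from-¬P
    where
    from-P : P s → Chain P s t
    from-P ps with P? x
    ... | yes px = step ps s~x (proj₁ (go c pt) px)
    ... | no ¬px = proj₂ (go c pt) ¬px ps s~x
    from-¬P : ¬ P s → ∀ {y} → P y → ShareEnd y s → Chain P y t
    from-¬P ¬ps {y} py y~s with P? x
    ... | yes px = step py (bypass p's ¬ps (P⊆P' py) (P⊆P' px) (λ { refl → ¬ps py }) (λ { refl → ¬ps px }) y~s s~x)
                           (proj₁ (go c pt) px)
    ... | no ¬px with x ≟D s
    ...   | yes refl = proj₂ (go c pt) ¬px py y~s
    ...   | no x≢s = proj₂ (go c pt) ¬px py (bypass p's ¬ps (P⊆P' py) (Chain-head c) (λ { refl → ¬ps py }) x≢s y~s s~x)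

¬Cross-triangle : ∀ {p q x y z} → y < z →
  Cross (x , y) (p , q) → Cross (y , z) (p , q) → Cross (x , z) (p , q) → ⊥
¬Cross-triangle _ (inj₁ (_ , p<y , _)) (inj₁ (y<p , _ , _)) _ = <-asym y<p p<y
¬Cross-triangle _ (inj₁ _) (inj₂ (_ , _ , q<z)) (inj₁ (_ , _ , z<q)) = <-asym q<z z<q
¬Cross-triangle _ (inj₁ (x<p , _ , _)) (inj₂ _) (inj₂ (p<x , _ , _)) = <-asym x<p p<x
¬Cross-triangle y<z (inj₂ (_ , _ , q<y)) (inj₁ (_ , _ , z<q)) _ = <-asym (q<y ⟫ y<z) z<q
¬Cross-triangle _ (inj₂ (_ , _ , q<y)) (inj₂ (_ , y<q , _)) _ = <-asym y<q q<y

-- Side A of r = (u , v) is the arc u < x < v, side B the complementary arc.  Au s says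
-- that s is a chord of side A at u other than r; Bu₁, Bu₂ are the two shapes of a chord
-- of side B at u.
module Geometry (p q u v : ℕ) where

  δ r : Diag
  δ = (p , q)
  r = (u , v)

  Au Av Bu₁ Bu₂ Bv₁ Bv₂ Bu Bv : Diag → Set
  Au (c , d) = c ≡ u × d < v
  Av (c , d) = d ≡ v × u < c
  Bu₁ (c , d) = d ≡ u × c < u
  Bu₂ (c , d) = c ≡ u × v < d
  Bv₁ (c , d) = c ≡ v × v < d
  Bv₂ (c , d) = d ≡ v × c < u
  Bu s = Bu₁ s ⊎ Bu₂ s
  Bv s = Bv₁ s ⊎ Bv₂ s

  SideA SideB : Diag → Set
  SideA (c , d) = u ≤ c × d ≤ v × (c , d) ≢ r
  SideB (c , d) = (c ≤ u ⊎ v ≤ c) × (d ≤ u ⊎ v ≤ d) × (c , d) ≢ r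

  SideA? : Decidable SideA
  SideA? (c , d) = (u ≤? c) ×-dec (d ≤? v) ×-dec ¬? ((c , d) ≟D r)

  SideB? : Decidable SideB
  SideB? (c , d) = ((c ≤? u) ⊎-dec (v ≤? c)) ×-dec ((d ≤? u) ⊎-dec (v ≤? d)) ×-dec ¬? ((c , d) ≟D r)

  Au? : Decidable Au
  Au? (c , d) = (c ≟ u) ×-dec (d <? v)

  Bv₁? : Decidable Bv₁
  Bv₁? (c , d) = (c ≟ v) ×-dec (v <? d)

  Bv₂? : Decidable Bv₂
  Bv₂? (c , d) = (d ≟ v) ×-dec (c <? u)

  -- A line crossing two chords from a common endpoint crosses every chord from that
  -- endpoint lying between them.
  Au-spoke : Cross r δ → ∀ {a x} → a < v → Cross (u , a) δ → u < x → x < v →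
             ¬ Separates (u , a) x v → Cross (u , x) δ
  Au-spoke _ {a} {x} a<v u-a×δ u<x x<v ¬sep with <-cmp x a
  ... | tri< x<a _ _ = ⊥-elim (¬sep (inj₁ ((u<x , x<a) , inj₂ a<v)))
  ... | tri≈ _ refl _ = u-a×δ
  Au-spoke (inj₁ (u<p , _ , v<q)) _ (inj₁ (_ , p<a , _)) _ x<v _ | tri> _ _ a<x = inj₁ (u<p , p<a ⟫ a<x , x<v ⟫ v<q)
  Au-spoke (inj₁ (u<p , _ , _)) _ (inj₂ (p<u , _ , _)) _ _ _ | tri> _ _ _ = ⊥-elim (<-asym u<p p<u)
  Au-spoke (inj₂ (p<u , _ , _)) _ (inj₁ (u<p , _ , _)) _ _ _ | tri> _ _ _ = ⊥-elim (<-asym u<p p<u)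
  Au-spoke (inj₂ (p<u , u<q , _)) _ (inj₂ (_ , _ , q<a)) _ _ _ | tri> _ _ a<x = inj₂ (p<u , u<q , q<a ⟫ a<x)

  Av-spoke : Cross r δ → ∀ {a x} → u < a → Cross (a , v) δ → u < x → x < v →
             ¬ Separates (a , v) x u → Cross (x , v) δ
  Av-spoke _ {a} {x} u<a a-v×δ u<x x<v ¬sep with <-cmp a x
  ... | tri< a<x _ _ = ⊥-elim (¬sep (inj₁ ((a<x , x<v) , inj₁ u<a)))
  ... | tri≈ _ refl _ = a-v×δ
  Av-spoke (inj₁ (_ , p<v , v<q)) _ (inj₁ (a<p , _ , _)) _ _ _ | tri> _ _ x<a = inj₁ (x<a ⟫ a<p , p<v , v<q)
  Av-spoke (inj₁ (_ , _ , v<q)) _ (inj₂ (_ , _ , q<v)) _ _ _ | tri> _ _ _ = ⊥-elim (<-asym v<q q<v)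
  Av-spoke (inj₂ (_ , _ , q<v)) _ (inj₁ (_ , _ , v<q)) _ _ _ | tri> _ _ _ = ⊥-elim (<-asym v<q q<v)
  Av-spoke (inj₂ (p<u , _ , q<v)) _ (inj₂ (_ , a<q , _)) u<x _ _ | tri> _ _ x<a = inj₂ (p<u ⟫ u<x , x<a ⟫ a<q , q<v)

  Bv₁-spoke : Cross r δ → u < v → ∀ {d b} → v < d → Cross (v , d) δ → Outside r b →
              ¬ Separates (v , d) b u → Cross (seg v b) δ
  Bv₁-spoke (inj₂ (p<u , _ , _)) u<v _ (inj₁ (v<p , _ , _)) _ _ = ⊥-elim (<-asym v<p (p<u ⟫ u<v))
  Bv₁-spoke (inj₂ (_ , _ , q<v)) _ _ (inj₂ (_ , v<q , _)) _ _ = ⊥-elim (<-asym v<q q<v)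
  Bv₁-spoke (inj₁ (_ , p<v , _)) _ _ (inj₁ (v<p , _ , _)) _ _ = ⊥-elim (<-asym v<p p<v)
  Bv₁-spoke (inj₁ (_ , p<v , v<q)) u<v {d} {b} _ (inj₂ (_ , _ , q<d)) (inj₂ v<b) ¬sep rewrite seg-< v<b with <-cmp b d
  ... | tri< b<d _ _ = ⊥-elim (¬sep (inj₁ ((v<b , b<d) , inj₁ u<v)))
  ... | tri≈ _ refl _ = inj₂ (p<v , v<q , q<d)
  ... | tri> _ _ d<b = inj₂ (p<v , v<q , q<d ⟫ d<b)
  Bv₁-spoke (inj₁ (u<p , p<v , v<q)) u<v _ (inj₂ _) (inj₁ b<u) _ rewrite seg-> (b<u ⟫ u<v) = inj₁ (b<u ⟫ u<p , p<v , v<q)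

  Bv₂-spoke : Cross r δ → u < v → ∀ {c b} → c < u → Cross (c , v) δ → Outside r b →
              ¬ Separates (c , v) b u → Cross (seg v b) δ
  Bv₂-spoke _ u<v c<u _ (inj₂ v<b) ¬sep = ⊥-elim (¬sep (inj₂ (inj₂ v<b , (c<u , u<v))))
  Bv₂-spoke _ u<v {c} {b} c<u _ (inj₁ b<u) ¬sep rewrite seg-> (b<u ⟫ u<v) with <-cmp b c
  ... | tri< b<c _ _ = ⊥-elim (¬sep (inj₂ (inj₁ b<c , (c<u , u<v))))
  Bv₂-spoke (inj₁ (u<p , p<v , v<q)) _ _ _ (inj₁ b<u) _ | _ = inj₁ (b<u ⟫ u<p , p<v , v<q)
  Bv₂-spoke (inj₂ (_ , _ , q<v)) _ _ (inj₁ (_ , _ , v<q)) (inj₁ _) _ | _ = ⊥-elim (<-asym v<q q<v)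
  Bv₂-spoke (inj₂ (_ , u<q , q<v)) _ _ (inj₂ (p<c , _ , _)) (inj₁ b<u) _ | tri≈ _ refl _ = inj₂ (p<c , b<u ⟫ u<q , q<v)
  Bv₂-spoke (inj₂ (_ , u<q , q<v)) _ _ (inj₂ (p<c , _ , _)) (inj₁ b<u) _ | tri> _ _ c<b = inj₂ (p<c ⟫ c<b , b<u ⟫ u<q , q<v)

  Bu₁-spoke : Cross r δ → u < v → ∀ {c b} → c < u → Cross (c , u) δ → Outside r b →
              ¬ Separates (c , u) b v → Cross (seg b u) δ
  Bu₁-spoke (inj₁ (u<p , _ , _)) _ _ (inj₁ (_ , p<u , _)) _ _ = ⊥-elim (<-asym u<p p<u)
  Bu₁-spoke (inj₁ (u<p , _ , _)) _ c<u (inj₂ (p<c , _ , _)) _ _ = ⊥-elim (<-asym (c<u ⟫ u<p) p<c)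
  Bu₁-spoke (inj₂ (_ , u<q , _)) _ _ (inj₂ (_ , _ , q<u)) _ _ = ⊥-elim (<-asym u<q q<u)
  Bu₁-spoke (inj₂ (p<u , u<q , q<v)) u<v _ (inj₁ _) (inj₂ v<b) _ rewrite seg-> (u<v ⟫ v<b) = inj₂ (p<u , u<q , q<v ⟫ v<b)
  Bu₁-spoke (inj₂ (p<u , u<q , _)) u<v {c} {b} _ (inj₁ (c<p , _ , _)) (inj₁ b<u) ¬sep rewrite seg-< b<u with <-cmp c b
  ... | tri< c<b _ _ = ⊥-elim (¬sep (inj₁ ((c<b , b<u) , inj₂ u<v)))
  ... | tri≈ _ refl _ = inj₁ (c<p , p<u , u<q)
  ... | tri> _ _ b<c = inj₁ (b<c ⟫ c<p , p<u , u<q)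

  Bu₂-spoke : Cross r δ → u < v → ∀ {d b} → v < d → Cross (u , d) δ → Outside r b →
              ¬ Separates (u , d) b v → Cross (seg b u) δ
  Bu₂-spoke _ u<v v<d _ (inj₁ b<u) ¬sep = ⊥-elim (¬sep (inj₂ (inj₁ b<u , (u<v , v<d))))
  Bu₂-spoke _ u<v {d} {b} v<d _ (inj₂ v<b) ¬sep rewrite seg-> (u<v ⟫ v<b) with <-cmp d b
  ... | tri< d<b _ _ = ⊥-elim (¬sep (inj₂ (inj₂ d<b , (u<v , v<d))))
  Bu₂-spoke (inj₂ (p<u , u<q , q<v)) _ _ _ (inj₂ v<b) _ | _ = inj₂ (p<u , u<q , q<v ⟫ v<b)
  Bu₂-spoke (inj₁ (u<p , _ , _)) _ _ (inj₂ (p<u , _ , _)) (inj₂ _) _ | _ = ⊥-elim (<-asym u<p p<u)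
  Bu₂-spoke (inj₁ (u<p , p<v , _)) _ _ (inj₁ (_ , _ , d<q)) (inj₂ v<b) _ | tri≈ _ refl _ = inj₁ (u<p , p<v ⟫ v<b , d<q)
  Bu₂-spoke (inj₁ (u<p , p<v , _)) _ _ (inj₁ (_ , _ , d<q)) (inj₂ v<b) _ | tri> _ _ b<d = inj₁ (u<p , p<v ⟫ v<b , b<d ⟫ d<q)

  Au-Av-cross : Cross r δ → ∀ {a a'} → a < v → u < a' → Cross (u , a) δ → Cross (a' , v) δ → Cross (u , a) (a' , v)
  Au-Av-cross (inj₁ _) a<v u<a' (inj₁ (_ , p<a , _)) (inj₁ (a'<p , _ , _)) = inj₁ (u<a' , a'<p ⟫ p<a , a<v)
  Au-Av-cross (inj₁ (u<p , _ , _)) _ _ (inj₂ (p<u , _ , _)) _ = ⊥-elim (<-asym u<p p<u)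
  Au-Av-cross (inj₁ (_ , _ , v<q)) _ _ _ (inj₂ (_ , _ , q<v)) = ⊥-elim (<-asym v<q q<v)
  Au-Av-cross (inj₂ (p<u , _ , _)) _ _ (inj₁ (u<p , _ , _)) _ = ⊥-elim (<-asym u<p p<u)
  Au-Av-cross (inj₂ (_ , _ , q<v)) _ _ _ (inj₁ (_ , _ , v<q)) = ⊥-elim (<-asym v<q q<v)
  Au-Av-cross (inj₂ _) a<v u<a' (inj₂ (_ , _ , q<a)) (inj₂ (_ , a'<q , _)) = inj₁ (u<a' , a'<q ⟫ q<a , a<v)

  Bu-Bv-cross : Cross r δ → u < v → ∀ {s t} → Bu s → Bv t → Cross s δ → Cross t δ → Cross s t
  Bu-Bv-cross (inj₁ (u<p , _ , _)) _ (inj₁ (refl , _)) (inj₁ (refl , _)) (inj₁ (_ , p<u , _)) _ = ⊥-elim (<-asym u<p p<u)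
  Bu-Bv-cross (inj₁ (u<p , _ , _)) _ (inj₁ (refl , c<u)) (inj₁ (refl , _)) (inj₂ (p<c , _ , _)) _ = ⊥-elim (<-asym (c<u ⟫ u<p) p<c)
  Bu-Bv-cross (inj₂ (p<u , _ , _)) u<v (inj₁ (refl , _)) (inj₁ (refl , _)) _ (inj₁ (v<p , _ , _)) = ⊥-elim (<-asym v<p (p<u ⟫ u<v))
  Bu-Bv-cross (inj₂ (_ , _ , q<v)) _ (inj₁ (refl , _)) (inj₁ (refl , _)) _ (inj₂ (_ , v<q , _)) = ⊥-elim (<-asym v<q q<v)
  Bu-Bv-cross (inj₁ (u<p , _ , _)) _ (inj₁ (refl , _)) (inj₂ (refl , _)) (inj₁ (_ , p<u , _)) _ = ⊥-elim (<-asym u<p p<u)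
  Bu-Bv-cross (inj₁ (u<p , _ , _)) _ (inj₁ (refl , c<u)) (inj₂ (refl , _)) (inj₂ (p<c , _ , _)) _ = ⊥-elim (<-asym (c<u ⟫ u<p) p<c)
  Bu-Bv-cross (inj₂ (_ , _ , q<v)) _ (inj₁ (refl , _)) (inj₂ (refl , _)) _ (inj₁ (_ , _ , v<q)) = ⊥-elim (<-asym v<q q<v)
  Bu-Bv-cross (inj₂ (_ , u<q , _)) _ (inj₁ (refl , _)) (inj₂ (refl , _)) (inj₂ (_ , _ , q<u)) _ = ⊥-elim (<-asym u<q q<u)
  Bu-Bv-cross (inj₂ _) u<v (inj₁ (refl , _)) (inj₂ (refl , c'<u)) (inj₁ (c<p , _ , _)) (inj₂ (p<c' , _ , _)) = inj₁ (c<p ⟫ p<c' , c'<u , u<v)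
  Bu-Bv-cross (inj₂ (p<u , _ , _)) u<v (inj₂ (refl , _)) (inj₁ (refl , _)) _ (inj₁ (v<p , _ , _)) = ⊥-elim (<-asym v<p (p<u ⟫ u<v))
  Bu-Bv-cross (inj₂ (_ , _ , q<v)) _ (inj₂ (refl , _)) (inj₁ (refl , _)) _ (inj₂ (_ , v<q , _)) = ⊥-elim (<-asym v<q q<v)
  Bu-Bv-cross (inj₁ (_ , p<v , _)) _ (inj₂ (refl , _)) (inj₁ (refl , _)) _ (inj₁ (v<p , _ , _)) = ⊥-elim (<-asym v<p p<v)
  Bu-Bv-cross (inj₁ (u<p , _ , _)) _ (inj₂ (refl , _)) (inj₁ (refl , _)) (inj₂ (p<u , _ , _)) _ = ⊥-elim (<-asym u<p p<u)
  Bu-Bv-cross (inj₁ _) u<v (inj₂ (refl , v<d)) (inj₁ (refl , _)) (inj₁ (_ , _ , d<q)) (inj₂ (_ , _ , q<d')) = inj₁ (u<v , v<d , d<q ⟫ q<d')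
  Bu-Bv-cross _ u<v (inj₂ (refl , v<d)) (inj₂ (refl , c'<u)) _ _ = inj₂ (c'<u , u<v , v<d)

  side-of : ∀ {c d} → c < d → u < v → ¬ Cross (c , d) r → SideA (c , d) ⊎ SideB (c , d) ⊎ (c , d) ≡ r
  side-of {c} {d} c<d u<v ¬× with <-cmp c u
  ... | tri≈ _ refl _ with <-cmp d v
  ...   | tri< d<v _ _ = inj₁ (≤-refl , <⇒≤ d<v , λ { refl → <-irrefl refl d<v })
  ...   | tri≈ _ refl _ = inj₂ (inj₂ refl)
  ...   | tri> _ _ v<d = inj₂ (inj₁ (inj₁ ≤-refl , inj₂ (<⇒≤ v<d) , λ { refl → <-irrefl refl v<d }))
  side-of {c} {d} c<d u<v ¬× | tri< c<u _ _ with <-cmp d u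
  ...   | tri< d<u _ _ = inj₂ (inj₁ (inj₁ (<⇒≤ c<u) , inj₁ (<⇒≤ d<u) , λ { refl → <-irrefl refl c<u }))
  ...   | tri≈ _ refl _ = inj₂ (inj₁ (inj₁ (<⇒≤ c<u) , inj₁ ≤-refl , λ { refl → <-irrefl refl c<u }))
  ...   | tri> _ _ u<d with <-cmp d v
  ...     | tri< d<v _ _ = ⊥-elim (¬× (inj₁ (c<u , u<d , d<v)))
  ...     | tri≈ _ refl _ = inj₂ (inj₁ (inj₁ (<⇒≤ c<u) , inj₂ ≤-refl , λ { refl → <-irrefl refl c<u }))
  ...     | tri> _ _ v<d = inj₂ (inj₁ (inj₁ (<⇒≤ c<u) , inj₂ (<⇒≤ v<d) , λ { refl → <-irrefl refl c<u }))
  side-of {c} {d} c<d u<v ¬× | tri> _ _ u<c with <-cmp c v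
  ...   | tri< c<v _ _ with <-cmp v d
  ...     | tri< v<d _ _ = ⊥-elim (¬× (inj₂ (u<c , c<v , v<d)))
  ...     | tri≈ _ refl _ = inj₁ (<⇒≤ u<c , ≤-refl , λ { refl → <-irrefl refl u<c })
  ...     | tri> _ _ d<v = inj₁ (<⇒≤ u<c , <⇒≤ d<v , λ { refl → <-irrefl refl u<c })
  side-of {c} {d} c<d u<v ¬× | tri> _ _ u<c | tri≈ _ refl _ =
    inj₂ (inj₁ (inj₂ ≤-refl , inj₂ (<⇒≤ c<d) , λ { refl → <-irrefl refl u<c }))
  side-of {c} {d} c<d u<v ¬× | tri> _ _ u<c | tri> _ _ v<c =
    inj₂ (inj₁ (inj₂ (<⇒≤ v<c) , inj₂ (<⇒≤ (v<c ⟫ c<d)) , λ { refl → <-irrefl refl u<c }))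

  SideA⇒¬SideB : ∀ {c d} → c < d → SideA (c , d) → ¬ SideB (c , d)
  SideA⇒¬SideB c<d (_ , d≤v , _) (inj₂ v≤c , _ , _) = <⇒≱ (≤-<-trans v≤c c<d) d≤v
  SideA⇒¬SideB c<d (u≤c , _ , _) (_ , inj₁ d≤u , _) = <⇒≱ c<d (≤-trans d≤u u≤c)
  SideA⇒¬SideB c<d (u≤c , d≤v , ≢r) (inj₁ c≤u , inj₂ v≤d , _) = ≢r (cong₂ _,_ (≤-antisym c≤u u≤c) (≤-antisym d≤v v≤d))

  SideA-at-u : ∀ {c d} → c < d → SideA (c , d) → c ≤ u ⊎ v ≤ c → Au (c , d)
  SideA-at-u c<d (u≤c , d≤v , ≢r) (inj₁ c≤u) with ≤-antisym c≤u u≤c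
  ... | refl = refl , ≤∧≢⇒< d≤v (λ { refl → ≢r refl })
  SideA-at-u c<d (_ , d≤v , _) (inj₂ v≤c) = ⊥-elim (<⇒≱ (≤-<-trans v≤c c<d) d≤v)

  SideA-at-v : ∀ {c d} → c < d → SideA (c , d) → d ≤ u ⊎ v ≤ d → Av (c , d)
  SideA-at-v c<d (u≤c , _ , _) (inj₁ d≤u) = ⊥-elim (<⇒≱ c<d (≤-trans d≤u u≤c))
  SideA-at-v c<d (u≤c , d≤v , ≢r) (inj₂ v≤d) with ≤-antisym d≤v v≤d
  ... | refl = refl , ≤∧≢⇒< u≤c (λ { refl → ≢r refl })

  SideB-at-u : ∀ {c d} → c < d → SideB (c , d) → Incident u (c , d) → Bu (c , d)
  SideB-at-u c<d _ (inj₂ refl) = inj₁ (refl , c<d)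
  SideB-at-u c<d (_ , inj₁ d≤u , _) (inj₁ refl) = ⊥-elim (<⇒≱ c<d d≤u)
  SideB-at-u c<d (_ , inj₂ v≤d , ≢r) (inj₁ refl) = inj₂ (refl , ≤∧≢⇒< v≤d (λ { refl → ≢r refl }))

  SideB-at-v : ∀ {c d} → c < d → SideB (c , d) → Incident v (c , d) → Bv (c , d)
  SideB-at-v c<d _ (inj₁ refl) = inj₁ (refl , c<d)
  SideB-at-v c<d (inj₁ c≤u , _ , ≢r) (inj₂ refl) = inj₂ (refl , ≤∧≢⇒< c≤u (λ { refl → ≢r refl }))
  SideB-at-v c<d (inj₂ v≤c , _ , _) (inj₂ refl) = ⊥-elim (<⇒≱ c<d v≤c)

  SideA-SideB-junction : ∀ {c d c' d'} → c < d → c' < d' → SideA (c , d) → SideB (c' , d') →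
    ShareEnd (c , d) (c' , d') → (Au (c , d) × Bu (c' , d')) ⊎ (Av (c , d) × Bv (c' , d'))
  SideA-SideB-junction c<d c'<d' sa sb (inj₁ refl) with SideA-at-u c<d sa (proj₁ sb)
  ... | au@(refl , _) = inj₁ (au , SideB-at-u c'<d' sb (inj₁ refl))
  SideA-SideB-junction c<d c'<d' sa sb (inj₂ (inj₁ refl)) with SideA-at-u c<d sa (proj₁ (proj₂ sb))
  ... | au@(refl , _) = inj₁ (au , SideB-at-u c'<d' sb (inj₂ refl))
  SideA-SideB-junction c<d c'<d' sa sb (inj₂ (inj₂ (inj₁ refl))) with SideA-at-v c<d sa (proj₁ sb)
  ... | av@(refl , _) = inj₂ (av , SideB-at-v c'<d' sb (inj₁ refl))
  SideA-SideB-junction c<d c'<d' sa sb (inj₂ (inj₂ (inj₂ refl))) with SideA-at-v c<d sa (proj₁ (proj₂ sb))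
  ... | av@(refl , _) = inj₂ (av , SideB-at-v c'<d' sb (inj₂ refl))

  SideA-r-junction : ∀ {c d} → c < d → SideA (c , d) → ShareEnd (c , d) r → Au (c , d) ⊎ Av (c , d)
  SideA-r-junction c<d sa (inj₁ refl) = inj₁ (SideA-at-u c<d sa (inj₁ ≤-refl))
  SideA-r-junction c<d sa (inj₂ (inj₁ refl)) = inj₁ (SideA-at-u c<d sa (inj₂ ≤-refl))
  SideA-r-junction c<d sa (inj₂ (inj₂ (inj₁ refl))) = inj₂ (SideA-at-v c<d sa (inj₁ ≤-refl))
  SideA-r-junction c<d sa (inj₂ (inj₂ (inj₂ refl))) = inj₂ (SideA-at-v c<d sa (inj₂ ≤-refl))

  SideB-r-junction : ∀ {c d} → c < d → SideB (c , d) → ShareEnd (c , d) r → Bu (c , d) ⊎ Bv (c , d)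
  SideB-r-junction c<d sb (inj₁ refl) = inj₁ (SideB-at-u c<d sb (inj₁ refl))
  SideB-r-junction c<d sb (inj₂ (inj₁ refl)) = inj₂ (SideB-at-v c<d sb (inj₁ refl))
  SideB-r-junction c<d sb (inj₂ (inj₂ (inj₁ refl))) = inj₁ (SideB-at-u c<d sb (inj₂ refl))
  SideB-r-junction c<d sb (inj₂ (inj₂ (inj₂ refl))) = inj₂ (SideB-at-v c<d sb (inj₂ refl))

  at-u : ∀ {s} → Au s ⊎ Bu s → Incident u s
  at-u (inj₁ (refl , _)) = inj₁ refl
  at-u (inj₂ (inj₁ (refl , _))) = inj₂ refl
  at-u (inj₂ (inj₂ (refl , _))) = inj₁ refl

  at-v : ∀ {s} → Av s ⊎ Bv s → Incident v s
  at-v (inj₁ (refl , _)) = inj₂ refl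
  at-v (inj₂ (inj₁ (refl , _))) = inj₁ refl
  at-v (inj₂ (inj₂ (refl , _))) = inj₂ refl

-- The sign ζ at a crossed diagonal

sign : Bool → Bool → ℤ
sign true  _     = - (+ 1)
sign false true  = + 1
sign false false = + 0

sign≡0 : ∀ {b c} → ¬ T b → ¬ T c → sign b c ≡ + 0
sign≡0 {true} ¬b _ = ⊥-elim (¬b tt)
sign≡0 {false} {true} _ ¬c = ⊥-elim (¬c tt)
sign≡0 {false} {false} _ _ = refl

sign≡0⁻ : ∀ {b c} → sign b c ≡ + 0 → ¬ T b × ¬ T c
sign≡0⁻ {false} {false} _ = (λ ()) , (λ ())

-- The definition of ζ at a crossed diagonal, with its two signAt values (see signAt-inside).
ζ-shape : ∀ b c₁ c₂ (z₁ z₂ : ℤ) → b ≡ true → z₁ ≡ - (+ 1) → z₂ ≡ + 1 →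
          (if not b then + 0 else (if c₁ then z₁ else (if c₂ then z₂ else + 0))) ≡ sign c₁ c₂
ζ-shape true true _ _ _ refl refl refl = refl
ζ-shape true false true _ _ refl refl refl = refl
ζ-shape true false false _ _ refl refl refl = refl

ζ-¬Cross : ∀ n R u v e → ¬ Cross (u , v) e → ζ n R (u , v) e ≡ + 0
ζ-¬Cross n R u v e ¬× with crossᵇ (u , v) e in eq
... | false = refl
... | true = ⊥-elim (¬× (Equivalence.to (T-crossᵇ (u , v) e) (subst T (sym eq) tt)))

signAt-inside : ∀ {u v a} → u < a → a < v → signAt u v a ≡ - (+ 1)
signAt-inside u<a a<v
  rewrite <⇒≺≡true (u<a ⟫ a<v) | ≮⇒≺≡false (<-asym a<v) | ≮⇒≺≡false (<-asym u<a)
        | <⇒≺≡true u<a | <⇒≺≡true a<v | ≮⇒≺≡false (<-asym (u<a ⟫ a<v)) = refl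

signAt-inside-reversed : ∀ {u v a} → u < a → a < v → signAt v u a ≡ + 1
signAt-inside-reversed u<a a<v
  rewrite <⇒≺≡true (u<a ⟫ a<v) | ≮⇒≺≡false (<-asym a<v) | ≮⇒≺≡false (<-asym u<a)
        | <⇒≺≡true u<a | <⇒≺≡true a<v | ≮⇒≺≡false (<-asym (u<a ⟫ a<v)) = refl

T-crossᵇ-seg : ∀ {x y e} → x < y → T (crossᵇ (seg x y) e) ⇔ Cross (x , y) e
T-crossᵇ-seg {e = e} x<y rewrite seg-< x<y = T-crossᵇ _ e

Cross-seg-< : ∀ {x y e} → x < y → Cross (seg x y) e → Cross (x , y) e
Cross-seg-< x<y rewrite seg-< x<y = id

Cross-seg-> : ∀ {x y e} → y < x → Cross (seg x y) e → Cross (y , x) e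
Cross-seg-> y<x rewrite seg-> y<x = id

-- Exits of δ at a crossed diagonal

BoundaryCrossedBy : ℕ → Diag → Diag → Set
BoundaryCrossedBy n e s = s ∈ hollowBoundary n × Cross s e

BoundaryCrossedBy⇒CrossedBy : ∀ {n} R {e s} → BoundaryCrossedBy n e s → CrossedBy n R e s
BoundaryCrossedBy⇒CrossedBy {n} R (s∈ , s×e) = ∈-++⁺ʳ R s∈ , s×e

accordion-connects-boundary : ∀ {n R e s t} → IsAccordion n R e →
  BoundaryCrossedBy n e s → BoundaryCrossedBy n e t → Chain (CrossedBy n R e) s t
accordion-connects-boundary {n} {R} acc s× t× =
  acc _ _ (BoundaryCrossedBy⇒CrossedBy {n} R s×) (BoundaryCrossedBy⇒CrossedBy {n} R t×)

module Dissection (n : ℕ) (2≤n : 2 ≤ n) (R : List Diag) (R-diss : HollowDissection n R) where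
  open Polygon n 2≤n

  closure-hollow : ∀ {s} → s ∈ closure n R → HollowDiag n s
  closure-hollow {s} s∈ with ∈-++⁻ R s∈
  ... | inj₁ s∈R = proj₁ (proj₁ R-diss s s∈R)
  ... | inj₂ s∈B = boundary-hollow s∈B

  closure-< : ∀ {s} → s ∈ closure n R → proj₁ s < proj₂ s
  closure-< s∈ = proj₂ (proj₂ (closure-hollow s∈))

  closure-¬Cross : ∀ {s t} → s ∈ closure n R → t ∈ closure n R → ¬ Cross s t
  closure-¬Cross {s} {t} s∈ t∈ with ∈-++⁻ R s∈ | ∈-++⁻ R t∈
  ... | inj₁ s∈R | inj₁ t∈R = proj₂ R-diss s t s∈R t∈R
  ... | inj₂ s∈B | _ = boundary-¬Cross {n} s∈B (proj₁ (closure-hollow t∈)) (proj₁ (proj₂ (closure-hollow t∈)))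
  ... | inj₁ _ | inj₂ t∈B =
        boundary-¬Cross {n} t∈B (proj₁ (closure-hollow s∈)) (proj₁ (proj₂ (closure-hollow s∈))) ∘ Cross-sym

  module CrossedDiagonal (p q : ℕ) (δ-solid : SolidDiag n (p , q)) (u v : ℕ) (r∈R : (u , v) ∈ R)
                   (r×δ : Cross (u , v) (p , q)) where
    open Geometry p q u v public

    r-internal : InternalHollowDiag n r
    r-internal = proj₁ R-diss r r∈R

    u-hollow : IsHollow n u
    u-hollow = proj₁ (proj₁ r-internal)

    v-hollow : IsHollow n v
    v-hollow = proj₁ (proj₂ (proj₁ r-internal))

    u<v : u < v
    u<v = proj₂ (proj₂ (proj₁ r-internal))

    u-odd : Odd u
    u-odd = IsHollow⇒Odd {n} u-hollow

    v-odd : Odd v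
    v-odd = IsHollow⇒Odd {n} v-hollow

    boundary≢r : ∀ {s} → s ∈ hollowBoundary n → s ≢ r
    boundary≢r s∈ refl = proj₂ r-internal (∈-hollowBoundary⇒IsHollowBoundary {n} s∈)

    closure-¬Cross-r : ∀ {s} → s ∈ closure n R → ¬ Cross s r
    closure-¬Cross-r s∈ = closure-¬Cross s∈ (∈-++⁺ˡ r∈R)

    closure-unseparated : ∀ {x} → IsHollow n x → Unseparated R u v x → Unseparated (closure n R) u v x
    closure-unseparated hx un s s∈ with ∈-++⁻ R s∈
    ... | inj₁ s∈R = un s s∈R
    ... | inj₂ s∈B = boundary-¬Separates {n} s∈B hx u-hollow , boundary-¬Separates {n} s∈B hx v-hollow

    ¬SideA⇒SideB-or-r : ∀ {s} → s ∈ closure n R → ¬ SideA s → SideB s ⊎ s ≡ r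
    ¬SideA⇒SideB-or-r s∈ ¬a with side-of (closure-< s∈) u<v (closure-¬Cross-r s∈)
    ... | inj₁ a = ⊥-elim (¬a a)
    ... | inj₂ b-or-r = b-or-r

    ¬SideB⇒SideA-or-r : ∀ {s} → s ∈ closure n R → ¬ SideB s → SideA s ⊎ s ≡ r
    ¬SideB⇒SideA-or-r s∈ ¬b with side-of (closure-< s∈) u<v (closure-¬Cross-r s∈)
    ... | inj₁ a = inj₁ a
    ... | inj₂ (inj₁ b) = ⊥-elim (¬b b)
    ... | inj₂ (inj₂ s≡r) = inj₂ s≡r

    maximal-Au-unseparated : ∀ {a c d} → ¬ Cross (c , d) r → ¬ Cross (u , a) (c , d) → (Au (c , d) → d ≤ a) →
                             u < a → a < v → ¬ Separates (c , d) a u × ¬ Separates (c , d) a v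
    maximal-Au-unseparated {a} {c} {d} ¬×r ¬×ua max u<a a<v = ¬sep-u , ¬sep-v
      where
      ¬sep-u : ¬ Separates (c , d) a u
      ¬sep-u (inj₁ ((c<a , a<d) , inj₁ u<c)) = ¬×ua (inj₁ (u<c , c<a , a<d))
      ¬sep-u (inj₁ ((_ , a<d) , inj₂ d<u)) = <-asym (a<d ⟫ d<u) u<a
      ¬sep-u (inj₂ (inj₁ a<c , (c<u , _))) = <-asym (a<c ⟫ c<u) u<a
      ¬sep-u (inj₂ (inj₂ d<a , (c<u , u<d))) = ¬×ua (inj₂ (c<u , u<d , d<a))
      ¬sep-v : ¬ Separates (c , d) a v
      ¬sep-v (inj₁ ((c<a , _) , inj₁ v<c)) = <-asym (c<a ⟫ a<v) v<c
      ¬sep-v (inj₁ ((c<a , a<d) , inj₂ d<v)) with <-cmp c u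
      ... | tri< c<u _ _ = ¬×r (inj₁ (c<u , u<a ⟫ a<d , d<v))
      ... | tri≈ _ c≡u _ = <⇒≱ a<d (max (c≡u , d<v))
      ... | tri> _ _ u<c = ¬×ua (inj₁ (u<c , c<a , a<d))
      ¬sep-v (inj₂ (inj₁ a<c , (c<v , v<d))) = ¬×r (inj₂ (u<a ⟫ a<c , c<v , v<d))
      ¬sep-v (inj₂ (inj₂ d<a , (_ , v<d))) = <-asym (d<a ⟫ a<v) v<d

    u+2<v : suc (suc u) < v
    u+2<v = ≤∧≢⇒< (odd-gap u-odd v-odd u<v) (λ u+2≡v → proj₂ r-internal (inj₁ (trans (sym u+2≡v) (+-comm 2 u))))

    cellA-nonempty : ∃[ x ] x ∈ cellA n R u v
    cellA-nonempty with maximum-where Au Au? proj₂ (closure n R)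
    ... | inj₂ no-Au =
          ⊥-elim (no-Au (u , suc (suc u))
                   (∈-++⁺ʳ R (∈-hollowBoundary⁺ {n} u-odd (<-≤-trans u+2<v (proj₂ (proj₂ v-hollow)))))
                   (refl , u+2<v))
    ... | inj₁ ((_ , a) , s∈ , (refl , a<v) , max) =
          a , ∈-cellA⁺ {n} {R} (proj₁ (proj₂ (closure-hollow s∈))) u<a a<v λ where
            (c , d) t∈R → let t∈ = ∈-++⁺ˡ t∈R in
              maximal-Au-unseparated (closure-¬Cross-r t∈) (closure-¬Cross s∈ t∈) (max (c , d) t∈) u<a a<v
      where
      u<a : u < a
      u<a = proj₂ (proj₂ (closure-hollow s∈))

    maximal-Bv₂-unseparated : ∀ {b c d} → ¬ Cross (c , d) r → ¬ Cross (c , d) (b , v) → (Bv₂ (c , d) → c ≤ b) →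
                              b < u → ¬ Separates (c , d) b u × ¬ Separates (c , d) b v
    maximal-Bv₂-unseparated {b} {c} {d} ¬×r ¬×bv max b<u = ¬sep-u , ¬sep-v
      where
      ¬sep-u : ¬ Separates (c , d) b u
      ¬sep-u (inj₁ ((c<b , _) , inj₁ u<c)) = <-asym (c<b ⟫ b<u) u<c
      ¬sep-u (inj₁ ((c<b , b<d) , inj₂ d<u)) = ¬×bv (inj₁ (c<b , b<d , d<u ⟫ u<v))
      ¬sep-u (inj₂ (inj₁ b<c , (c<u , u<d))) with <-cmp d v
      ... | tri< d<v _ _ = ¬×r (inj₁ (c<u , u<d , d<v))
      ... | tri≈ _ d≡v _ = <⇒≱ b<c (max (d≡v , c<u))
      ... | tri> _ _ v<d = ¬×bv (inj₂ (b<c , c<u ⟫ u<v , v<d))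
      ¬sep-u (inj₂ (inj₂ d<b , (_ , u<d))) = <-asym (d<b ⟫ b<u) u<d
      ¬sep-v : ¬ Separates (c , d) b v
      ¬sep-v (inj₁ ((c<b , _) , inj₁ v<c)) = <-asym (c<b ⟫ b<u ⟫ u<v) v<c
      ¬sep-v (inj₁ ((c<b , b<d) , inj₂ d<v)) = ¬×bv (inj₁ (c<b , b<d , d<v))
      ¬sep-v (inj₂ (inj₁ b<c , (c<v , v<d))) = ¬×bv (inj₂ (b<c , c<v , v<d))
      ¬sep-v (inj₂ (inj₂ d<b , (_ , v<d))) = <-asym (d<b ⟫ b<u ⟫ u<v) v<d

    maximal-Bv₁-unseparated : ∀ {b c d} → ¬ Cross (c , d) r → ¬ Cross (c , d) (v , b) → (Bv₁ (c , d) → d ≤ b) →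
                              ¬ Bv₂ (c , d) → v < b → ¬ Separates (c , d) b u × ¬ Separates (c , d) b v
    maximal-Bv₁-unseparated {b} {c} {d} ¬×r ¬×vb max ¬bv₂ v<b = ¬sep-u , ¬sep-v
      where
      ¬sep-u : ¬ Separates (c , d) b u
      ¬sep-u (inj₁ ((c<b , b<d) , inj₁ u<c)) with <-cmp c v
      ... | tri< c<v _ _ = ¬×r (inj₂ (u<c , c<v , v<b ⟫ b<d))
      ... | tri≈ _ c≡v _ = <⇒≱ b<d (max (c≡v , v<b ⟫ b<d))
      ... | tri> _ _ v<c = ¬×vb (inj₂ (v<c , c<b , b<d))
      ¬sep-u (inj₁ ((_ , b<d) , inj₂ d<u)) = <-asym (d<u ⟫ u<v ⟫ v<b) b<d
      ¬sep-u (inj₂ (inj₁ b<c , (c<u , _))) = <-asym (c<u ⟫ u<v ⟫ v<b) b<c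
      ¬sep-u (inj₂ (inj₂ d<b , (c<u , u<d))) with <-cmp d v
      ... | tri< d<v _ _ = ¬×r (inj₁ (c<u , u<d , d<v))
      ... | tri≈ _ d≡v _ = ¬bv₂ (d≡v , c<u)
      ... | tri> _ _ v<d = ¬×vb (inj₁ (c<u ⟫ u<v , v<d , d<b))
      ¬sep-v : ¬ Separates (c , d) b v
      ¬sep-v (inj₁ ((c<b , b<d) , inj₁ v<c)) = ¬×vb (inj₂ (v<c , c<b , b<d))
      ¬sep-v (inj₁ ((_ , b<d) , inj₂ d<v)) = <-asym (d<v ⟫ v<b) b<d
      ¬sep-v (inj₂ (inj₁ b<c , (c<v , _))) = <-asym (c<v ⟫ v<b) b<c
      ¬sep-v (inj₂ (inj₂ d<b , (c<v , v<d))) = ¬×vb (inj₁ (c<v , v<d , d<b))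

    cellB-nonempty : ∃[ x ] x ∈ cellB n R u v
    cellB-nonempty with maximum-where Bv₂ Bv₂? proj₁ (closure n R)
    ... | inj₁ ((b , _) , s∈ , (refl , b<u) , max) =
          b , ∈-cellB⁺ {n} {R} (proj₁ (closure-hollow s∈)) (inj₁ b<u) λ where
            (c , d) t∈R → let t∈ = ∈-++⁺ˡ t∈R in
              maximal-Bv₂-unseparated (closure-¬Cross-r t∈) (closure-¬Cross t∈ s∈) (max (c , d) t∈) b<u
    ... | inj₂ no-Bv₂ with maximum-where Bv₁ Bv₁? proj₂ (closure n R)
    ...   | inj₁ ((_ , b) , s∈ , (refl , v<b) , max) =
            b , ∈-cellB⁺ {n} {R} (proj₁ (proj₂ (closure-hollow s∈))) (inj₂ v<b) λ where
              (c , d) t∈R → let t∈ = ∈-++⁺ˡ t∈R in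
                maximal-Bv₁-unseparated (closure-¬Cross-r t∈) (closure-¬Cross t∈ s∈) (max (c , d) t∈)
                  (no-Bv₂ (c , d) t∈) v<b
    ...   | inj₂ no-Bv₁ with v <? 2 * n ∸ 1
    ...     | yes v<2n-1 =
              ⊥-elim (no-Bv₁ (v , suc (suc v))
                       (∈-++⁺ʳ R (∈-hollowBoundary⁺ {n} v-odd (≤-<-trans (odd-gap v-odd 2n-1-odd v<2n-1) 2n-1<2n)))
                       (refl , n<1+n _ ⟫ n<1+n _))
    ...     | no v≮2n-1 = ⊥-elim (no-Bv₂ (1 , 2 * n ∸ 1) (∈-++⁺ʳ R (here refl)) (2n-1≡v , 1<u))
      where
      2n-1≡v : 2 * n ∸ 1 ≡ v
      2n-1≡v = sym (≤-antisym (IsHollow⇒≤2n-1 {n} v-hollow) (≮⇒≥ v≮2n-1))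
      1<u : 1 < u
      1<u = ≤∧≢⇒< (Odd⇒1≤ u-odd) (λ 1≡u → proj₂ r-internal (inj₂ (sym 1≡u , sym 2n-1≡v)))

    a₁ aₖ b₁ bₖ : ℕ
    a₁ = firstOr (cellA n R u v)
    aₖ = lastOr (cellA n R u v)
    b₁ = firstOr (cellB n R u v)
    bₖ = lastOr (cellB n R u v)

    a₁∈ : a₁ ∈ cellA n R u v
    a₁∈ = firstOr-∈ (proj₂ cellA-nonempty)

    aₖ∈ : aₖ ∈ cellA n R u v
    aₖ∈ = lastOr-∈ (proj₂ cellA-nonempty)

    b₁∈ : b₁ ∈ cellB n R u v
    b₁∈ = firstOr-∈ (proj₂ cellB-nonempty)

    bₖ∈ : bₖ ∈ cellB n R u v
    bₖ∈ = lastOr-∈ (proj₂ cellB-nonempty)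

    u<a₁ : u < a₁
    u<a₁ = proj₁ (proj₂ (∈-cellA⁻ {n} {R} a₁∈))

    a₁<v : a₁ < v
    a₁<v = proj₁ (proj₂ (proj₂ (∈-cellA⁻ {n} {R} a₁∈)))

    u<aₖ : u < aₖ
    u<aₖ = proj₁ (proj₂ (∈-cellA⁻ {n} {R} aₖ∈))

    aₖ<v : aₖ < v
    aₖ<v = proj₁ (proj₂ (proj₂ (∈-cellA⁻ {n} {R} aₖ∈)))

    -- Exit K: δ crosses a segment of R̄ of kind K; by the spoke lemmas this decides at
    -- which endpoint of r δ leaves the cell of R on that side.
    Exit : (Diag → Set) → Set
    Exit K = ∃[ s ] CrossedBy n R δ s × K s

    Exit-Au⇒Cross-u-x : ∀ {x} → x ∈ cellA n R u v → Exit Au → Cross (u , x) δ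
    Exit-Au⇒Cross-u-x x∈ ((_ , _) , (s∈ , s×δ) , (refl , a<v)) with ∈-cellA⁻ {n} {R} x∈
    ... | hx , u<x , x<v , un = Au-spoke r×δ a<v s×δ u<x x<v (proj₂ (closure-unseparated hx un _ s∈))

    Exit-Av⇒Cross-x-v : ∀ {x} → x ∈ cellA n R u v → Exit Av → Cross (x , v) δ
    Exit-Av⇒Cross-x-v x∈ ((_ , _) , (s∈ , s×δ) , (refl , u<a)) with ∈-cellA⁻ {n} {R} x∈
    ... | hx , u<x , x<v , un = Av-spoke r×δ u<a s×δ u<x x<v (proj₁ (closure-unseparated hx un _ s∈))

    Exit-Bv⇒Cross-v-x : ∀ {x} → x ∈ cellB n R u v → Exit Bv → Cross (seg v x) δ
    Exit-Bv⇒Cross-v-x x∈ ((_ , _) , (s∈ , s×δ) , inj₁ (refl , v<d)) with ∈-cellB⁻ {n} {R} x∈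
    ... | hx , out , un = Bv₁-spoke r×δ u<v v<d s×δ out (proj₁ (closure-unseparated hx un _ s∈))
    Exit-Bv⇒Cross-v-x x∈ ((_ , _) , (s∈ , s×δ) , inj₂ (refl , c<u)) with ∈-cellB⁻ {n} {R} x∈
    ... | hx , out , un = Bv₂-spoke r×δ u<v c<u s×δ out (proj₁ (closure-unseparated hx un _ s∈))

    Exit-Bu⇒Cross-x-u : ∀ {x} → x ∈ cellB n R u v → Exit Bu → Cross (seg x u) δ
    Exit-Bu⇒Cross-x-u x∈ ((_ , _) , (s∈ , s×δ) , inj₁ (refl , c<u)) with ∈-cellB⁻ {n} {R} x∈
    ... | hx , out , un = Bu₁-spoke r×δ u<v c<u s×δ out (proj₂ (closure-unseparated hx un _ s∈))
    Exit-Bu⇒Cross-x-u x∈ ((_ , _) , (s∈ , s×δ) , inj₂ (refl , v<d)) with ∈-cellB⁻ {n} {R} x∈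
    ... | hx , out , un = Bu₂-spoke r×δ u<v v<d s×δ out (proj₂ (closure-unseparated hx un _ s∈))

    Exit-Au⇒¬Cross-x-v : ∀ {x} → x ∈ cellA n R u v → Exit Au → ¬ Cross (x , v) δ
    Exit-Au⇒¬Cross-x-v x∈ X x-v×δ with ∈-cellA⁻ {n} {R} x∈
    ... | _ , _ , x<v , _ = ¬Cross-triangle x<v (Exit-Au⇒Cross-u-x x∈ X) x-v×δ r×δ

    Exit-Av⇒¬Cross-u-x : ∀ {x} → x ∈ cellA n R u v → Exit Av → ¬ Cross (u , x) δ
    Exit-Av⇒¬Cross-u-x x∈ X u-x×δ with ∈-cellA⁻ {n} {R} x∈
    ... | _ , _ , x<v , _ = ¬Cross-triangle x<v u-x×δ (Exit-Av⇒Cross-x-v x∈ X) r×δ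

    Exit-Bv⇒¬Cross-x-u : ∀ {x} → x ∈ cellB n R u v → Exit Bv → ¬ Cross (seg x u) δ
    Exit-Bv⇒¬Cross-x-u x∈ X x-u×δ with proj₁ (proj₂ (∈-cellB⁻ {n} {R} x∈)) | Exit-Bv⇒Cross-v-x x∈ X
    ... | inj₂ v<x | v-x×δ =
          ¬Cross-triangle v<x r×δ (Cross-seg-< v<x v-x×δ) (Cross-seg-> (u<v ⟫ v<x) x-u×δ)
    ... | inj₁ x<u | v-x×δ =
          ¬Cross-triangle u<v (Cross-seg-< x<u x-u×δ) r×δ (Cross-seg-> (x<u ⟫ u<v) v-x×δ)

    Exit-Bu⇒¬Cross-v-x : ∀ {x} → x ∈ cellB n R u v → Exit Bu → ¬ Cross (seg v x) δ
    Exit-Bu⇒¬Cross-v-x x∈ X v-x×δ with proj₁ (proj₂ (∈-cellB⁻ {n} {R} x∈)) | Exit-Bu⇒Cross-x-u x∈ X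
    ... | inj₂ v<x | x-u×δ =
          ¬Cross-triangle v<x r×δ (Cross-seg-< v<x v-x×δ) (Cross-seg-> (u<v ⟫ v<x) x-u×δ)
    ... | inj₁ x<u | x-u×δ =
          ¬Cross-triangle u<v (Cross-seg-< x<u x-u×δ) r×δ (Cross-seg-> (x<u ⟫ u<v) v-x×δ)

    ¬Exit-Au×Av : Exit Au → Exit Av → ⊥
    ¬Exit-Au×Av ((_ , _) , (s∈ , s×δ) , (refl , a<v)) ((_ , _) , (t∈ , t×δ) , (refl , u<a')) =
      closure-¬Cross s∈ t∈ (Au-Av-cross r×δ a<v u<a' s×δ t×δ)

    ¬Exit-Bu×Bv : Exit Bu → Exit Bv → ⊥
    ¬Exit-Bu×Bv (_ , (s∈ , s×δ) , bu) (_ , (t∈ , t×δ) , bv) =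
      closure-¬Cross s∈ t∈ (Bu-Bv-cross r×δ u<v bu bv s×δ t×δ)

    p-even : Even p
    p-even = even (proj₁ (proj₁ δ-solid))

    q-even : Even q
    q-even = even (proj₁ (proj₁ (proj₂ δ-solid)))

    1≤p : 1 ≤ p
    1≤p = ≤-trans (s≤s z≤n) (proj₁ (proj₂ (proj₁ δ-solid)))

    p<q : p < q
    p<q = proj₂ (proj₂ δ-solid)

    q≤2n : q ≤ 2 * n
    q≤2n = proj₂ (proj₂ (proj₁ (proj₂ δ-solid)))

    p∸1<p : p ∸ 1 < p
    p∸1<p = subst (p ∸ 1 <_) (proj₂ (Even-pred p-even 1≤p)) ≤-refl

    q∸1<q : q ∸ 1 < q
    q∸1<q = subst (q ∸ 1 <_) (proj₂ (Even-pred q-even (≤-trans 1≤p (<⇒≤ p<q)))) ≤-refl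

    p<q∸1 : p < q ∸ 1
    p<q∸1 = <⇒≤∸1 (even-gap p-even q-even p<q)

    edge-p : BoundaryCrossedBy n δ (p ∸ 1 , suc p)
    edge-p = edge-around {n} p-even 1≤p (<-≤-trans p<q q≤2n) , inj₁ (p∸1<p , n<1+n p , even-gap p-even q-even p<q)

    edge-q : q < 2 * n → BoundaryCrossedBy n δ (q ∸ 1 , suc q)
    edge-q q<2n = edge-around {n} q-even (≤-trans 1≤p (<⇒≤ p<q)) q<2n , inj₂ (p<q∸1 , q∸1<q , n<1+n q)

    -- δ crosses the boundary edge around each of its endpoints (around q it is the
    -- edge 1 (2n-1) if q = 2n); one of them lies on side A of r, the other on side B.
    crossed-boundary-edges : (∃[ s ] BoundaryCrossedBy n δ s × SideA s) × (∃[ s ] BoundaryCrossedBy n δ s × SideB s)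
    crossed-boundary-edges = edges (q <? 2 * n) r×δ
      where
      edges : Dec (q < 2 * n) → Cross r δ →
              (∃[ s ] BoundaryCrossedBy n δ s × SideA s) × (∃[ s ] BoundaryCrossedBy n δ s × SideB s)
      edges (yes q<2n) (inj₂ (p<u , u<q , q<v)) =
        (_ , edge-q q<2n , <⇒≤∸1 u<q , q<v , boundary≢r (proj₁ (edge-q q<2n))) ,
        (_ , edge-p , inj₁ (<⇒≤ (p∸1<p ⟫ p<u)) , inj₁ p<u , boundary≢r (proj₁ edge-p))
      edges (yes q<2n) (inj₁ (u<p , p<v , v<q)) =
        (_ , edge-p , <⇒≤∸1 u<p , p<v , boundary≢r (proj₁ edge-p)) ,
        (_ , edge-q q<2n , inj₂ (<⇒≤∸1 v<q) , inj₂ (<⇒≤ (v<q ⟫ n<1+n q)) , boundary≢r (proj₁ (edge-q q<2n)))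
      edges (no q≮2n) (inj₂ (_ , _ , q<v)) = ⊥-elim (q≮2n (<-≤-trans q<v (proj₂ (proj₂ v-hollow))))
      edges (no q≮2n) (inj₁ (u<p , p<v , v<q)) =
        (_ , edge-p , <⇒≤∸1 u<p , p<v , boundary≢r (proj₁ edge-p)) ,
        (_ , (here refl , inj₁ (proj₁ (proj₂ (proj₁ δ-solid)) , p<2n-1 , 2n-1<q)) ,
         inj₁ (Odd⇒1≤ u-odd) , inj₂ v≤2n-1 , boundary≢r (here refl))
        where
        q≡2n : q ≡ 2 * n
        q≡2n = ≤-antisym q≤2n (≮⇒≥ q≮2n)
        p<2n-1 : p < 2 * n ∸ 1
        p<2n-1 = subst (λ z → p < z ∸ 1) q≡2n p<q∸1
        2n-1<q : 2 * n ∸ 1 < q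
        2n-1<q = subst (λ z → z ∸ 1 < q) q≡2n q∸1<q
        v≤2n-1 : v ≤ 2 * n ∸ 1
        v≤2n-1 = subst (λ z → v ≤ z ∸ 1) q≡2n (<⇒≤∸1 v<q)

    module _ {P : Diag → Set} (P⊆closure : ∀ {s} → P s → s ∈ closure n R)
             (connected : ∀ {s t} → BoundaryCrossedBy n δ s → BoundaryCrossedBy n δ t → Chain P s t) where

      SideA-exit : ∃[ x ] ∃[ y ] P x × P y × SideA x × (SideB y ⊎ y ≡ r) × ShareEnd x y
      SideA-exit with crossed-boundary-edges
      ... | (_ , sA× , sA-A) , (_ , sB× , sB-B)
          with Chain-exit SideA? (connected sA× sB×) sA-A
                 (λ sB-A → SideA⇒¬SideB (closure-< (∈-++⁺ʳ R (proj₁ sB×))) sB-A sB-B)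
      ...   | x , y , px , py , x-A , y-¬A , x~y = x , y , px , py , x-A , ¬SideA⇒SideB-or-r (P⊆closure py) y-¬A , x~y

      SideB-exit : ∃[ x ] ∃[ y ] P x × P y × SideB x × (SideA y ⊎ y ≡ r) × ShareEnd x y
      SideB-exit with crossed-boundary-edges
      ... | (_ , sA× , sA-A) , (_ , sB× , sB-B)
          with Chain-exit SideB? (connected sB× sA×) sB-B
                 (SideA⇒¬SideB (closure-< (∈-++⁺ʳ R (proj₁ sA×))) sA-A)
      ...   | x , y , px , py , x-B , y-¬B , x~y = x , y , px , py , x-B , ¬SideB⇒SideA-or-r (P⊆closure py) y-¬B , x~y

    module _ (acc : IsAccordion n R δ) where

      accordion⇒Exit-A : Exit Au ⊎ Exit Av
      accordion⇒Exit-A with SideA-exit proj₁ (accordion-connects-boundary {n} {R} acc)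
      ... | x , y , x× , y× , x-A , inj₁ y-B , x~y =
            Sum.map (λ j → x , x× , proj₁ j) (λ j → x , x× , proj₁ j)
              (SideA-SideB-junction (closure-< (proj₁ x×)) (closure-< (proj₁ y×)) x-A y-B x~y)
      ... | x , _ , x× , _ , x-A , inj₂ refl , x~r =
            Sum.map (λ au → x , x× , au) (λ av → x , x× , av) (SideA-r-junction (closure-< (proj₁ x×)) x-A x~r)

      accordion⇒Exit-B : Exit Bu ⊎ Exit Bv
      accordion⇒Exit-B with SideB-exit proj₁ (accordion-connects-boundary {n} {R} acc)
      ... | x , y , x× , y× , x-B , inj₁ y-A , x~y =
            Sum.map (λ j → x , x× , proj₂ j) (λ j → x , x× , proj₂ j)
              (SideA-SideB-junction (closure-< (proj₁ y×)) (closure-< (proj₁ x×)) y-A x-B (ShareEnd-sym x~y))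
      ... | x , _ , x× , _ , x-B , inj₂ refl , x~r =
            Sum.map (λ bu → x , x× , bu) (λ bv → x , x× , bv) (SideB-r-junction (closure-< (proj₁ x×)) x-B x~r)

      Cross-u-a₁⇔Exit-Au : Cross (u , a₁) δ ⇔ Exit Au
      Cross-u-a₁⇔Exit-Au = mk⇔ (λ u-a₁×δ → [ id , (λ X → ⊥-elim (Exit-Av⇒¬Cross-u-x a₁∈ X u-a₁×δ)) ]′ accordion⇒Exit-A)
                                (Exit-Au⇒Cross-u-x a₁∈)

      Cross-aₖ-v⇔Exit-Av : Cross (aₖ , v) δ ⇔ Exit Av
      Cross-aₖ-v⇔Exit-Av = mk⇔ (λ aₖ-v×δ → [ (λ X → ⊥-elim (Exit-Au⇒¬Cross-x-v aₖ∈ X aₖ-v×δ)) , id ]′ accordion⇒Exit-A)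
                                (Exit-Av⇒Cross-x-v aₖ∈)

      Cross-v-b₁⇔Exit-Bv : Cross (seg v b₁) δ ⇔ Exit Bv
      Cross-v-b₁⇔Exit-Bv = mk⇔ (λ v-b₁×δ → [ (λ X → ⊥-elim (Exit-Bu⇒¬Cross-v-x b₁∈ X v-b₁×δ)) , id ]′ accordion⇒Exit-B)
                                (Exit-Bv⇒Cross-v-x b₁∈)

      Cross-bₖ-u⇔Exit-Bu : Cross (seg bₖ u) δ ⇔ Exit Bu
      Cross-bₖ-u⇔Exit-Bu = mk⇔ (λ bₖ-u×δ → [ id , (λ X → ⊥-elim (Exit-Bv⇒¬Cross-x-u bₖ∈ X bₖ-u×δ)) ]′ accordion⇒Exit-B)
                                (Exit-Bu⇒Cross-x-u bₖ∈)

    C₁ C₂ : Bool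
    C₁ = crossᵇ (seg u a₁) δ ∧ crossᵇ (seg v b₁) δ
    C₂ = crossᵇ (seg aₖ v) δ ∧ crossᵇ (seg bₖ u) δ

    ζ≡sign : ζ n R r δ ≡ sign C₁ C₂
    ζ≡sign = ζ-shape (crossᵇ r δ) C₁ C₂ _ _ (T⇒≡true (Equivalence.from (T-crossᵇ r δ) r×δ))
               (signAt-inside u<a₁ a₁<v) (signAt-inside-reversed u<aₖ aₖ<v)

    T-C₁ : T C₁ ⇔ (Cross (u , a₁) δ × Cross (seg v b₁) δ)
    T-C₁ = (T-crossᵇ-seg u<a₁ ×-⇔ T-crossᵇ _ _) ⇔-∘ T-∧

    T-C₂ : T C₂ ⇔ (Cross (aₖ , v) δ × Cross (seg bₖ u) δ)
    T-C₂ = (T-crossᵇ-seg aₖ<v ×-⇔ T-crossᵇ _ _) ⇔-∘ T-∧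

    T-C₁⇔Exits : IsAccordion n R δ → T C₁ ⇔ (Exit Au × Exit Bv)
    T-C₁⇔Exits acc = (Cross-u-a₁⇔Exit-Au acc ×-⇔ Cross-v-b₁⇔Exit-Bv acc) ⇔-∘ T-C₁

    T-C₂⇔Exits : IsAccordion n R δ → T C₂ ⇔ (Exit Av × Exit Bu)
    T-C₂⇔Exits acc = (Cross-aₖ-v⇔Exit-Av acc ×-⇔ Cross-bₖ-u⇔Exit-Bu acc) ⇔-∘ T-C₂

    junction⇒ζ≡0 : ∀ {x y} → CrossedBy n R δ x → CrossedBy n R δ y → SideA x → SideB y → ShareEnd x y →
                   ζ n R r δ ≡ + 0
    junction⇒ζ≡0 {x} {y} x× y× x-A y-B x~y
      with SideA-SideB-junction (closure-< (proj₁ x×)) (closure-< (proj₁ y×)) x-A y-B x~y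
    ... | inj₁ (au , bu) =
          trans ζ≡sign (sign≡0 (Exit-Bu⇒¬Cross-v-x b₁∈ (y , y× , bu) ∘ proj₂ ∘ Equivalence.to T-C₁)
                                (Exit-Au⇒¬Cross-x-v aₖ∈ (x , x× , au) ∘ proj₁ ∘ Equivalence.to T-C₂))
    ... | inj₂ (av , bv) =
          trans ζ≡sign (sign≡0 (Exit-Av⇒¬Cross-u-x a₁∈ (x , x× , av) ∘ proj₁ ∘ Equivalence.to T-C₁)
                                (Exit-Bv⇒¬Cross-x-u bₖ∈ (y , y× , bv) ∘ proj₂ ∘ Equivalence.to T-C₂))

    r-neighbour : ∀ {y} → CrossedBy n R δ y → y ≢ r → ShareEnd y r → (Au y ⊎ Bu y) ⊎ (Av y ⊎ Bv y)
    r-neighbour (y∈ , _) y≢r y~r with side-of (closure-< y∈) u<v (closure-¬Cross-r y∈)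
    ... | inj₁ y-A = Sum.map inj₁ inj₁ (SideA-r-junction (closure-< y∈) y-A y~r)
    ... | inj₂ (inj₁ y-B) = Sum.map inj₂ inj₂ (SideB-r-junction (closure-< y∈) y-B y~r)
    ... | inj₂ (inj₂ y≡r) = ⊥-elim (y≢r y≡r)

    -- Two neighbours of r at opposite endpoints would cross each other if they lie on
    -- the same side of r, and would make ζ ≠ 0 if they lie on opposite sides.
    ζ≡0⇒bypassable : ζ n R r δ ≡ + 0 → Bypassable (CrossedBy n R δ) r
    ζ≡0⇒bypassable ζ≡0 {y} {z} y× z× y≢r z≢r y~r r~z with sign≡0⁻ {C₁} {C₂} (trans (sym ζ≡sign) ζ≡0)
    ... | ¬C₁ , ¬C₂ = meet (r-neighbour y× y≢r y~r) (r-neighbour z× z≢r (ShareEnd-sym r~z))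
      where
      opposite : ∀ {s t} → CrossedBy n R δ s → CrossedBy n R δ t → Au s ⊎ Bu s → Av t ⊎ Bv t → ⊥
      opposite {s} {t} s× t× (inj₁ au) (inj₁ av) = ¬Exit-Au×Av (s , s× , au) (t , t× , av)
      opposite {s} {t} s× t× (inj₂ bu) (inj₂ bv) = ¬Exit-Bu×Bv (s , s× , bu) (t , t× , bv)
      opposite {s} {t} s× t× (inj₁ au) (inj₂ bv) =
        ¬C₁ (Equivalence.from T-C₁ (Exit-Au⇒Cross-u-x a₁∈ (s , s× , au) , Exit-Bv⇒Cross-v-x b₁∈ (t , t× , bv)))
      opposite {s} {t} s× t× (inj₂ bu) (inj₁ av) =
        ¬C₂ (Equivalence.from T-C₂ (Exit-Av⇒Cross-x-v aₖ∈ (t , t× , av) , Exit-Bu⇒Cross-x-u bₖ∈ (s , s× , bu)))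
      meet : (Au y ⊎ Bu y) ⊎ (Av y ⊎ Bv y) → (Au z ⊎ Bu z) ⊎ (Av z ⊎ Bv z) → ShareEnd y z
      meet (inj₁ y-u) (inj₁ z-u) = Incident⇒ShareEnd (at-u y-u) (at-u z-u)
      meet (inj₂ y-v) (inj₂ z-v) = Incident⇒ShareEnd (at-v y-v) (at-v z-v)
      meet (inj₁ y-u) (inj₂ z-v) = ⊥-elim (opposite y× z× y-u z-v)
      meet (inj₂ y-v) (inj₁ z-u) = ⊥-elim (opposite z× y× z-u y-v)

resolve-⊎ : ∀ {K L K' L' : Set} → (L → L') → K ⊎ L → (K' → L' → ⊥) → K' → K
resolve-⊎ _ (inj₁ k) _ _ = k
resolve-⊎ L⇒L' (inj₂ l) excl k' = ⊥-elim (excl k' (L⇒L' l))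

module Refinement (n : ℕ) (2≤n : 2 ≤ n) (D D' : List Diag)
                  (D-diss : HollowDissection n D) (D'-diss : HollowDissection n D') (D⊆D' : D ⊆D D')
                  (p q : ℕ) (δ-solid : SolidDiag n (p , q)) where

  δ : Diag
  δ = (p , q)

  module Coarse = Dissection n 2≤n D D-diss
  module Fine = Dissection n 2≤n D' D'-diss

  closure-mono : ∀ {s} → s ∈ closure n D → s ∈ closure n D'
  closure-mono {s} s∈ with ∈-++⁻ D s∈
  ... | inj₁ s∈D = ∈-++⁺ˡ (D⊆D' s s∈D)
  ... | inj₂ s∈B = ∈-++⁺ʳ D' s∈B

  CrossedBy-mono : ∀ {s} → CrossedBy n D δ s → CrossedBy n D' δ s
  CrossedBy-mono (s∈ , s×δ) = closure-mono s∈ , s×δ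

  CrossedBy? : Decidable (CrossedBy n D δ)
  CrossedBy? s = (s ∈? closure n D) ×-dec Cross? s δ

  subspace⇒accordion : IsAccordion n D' δ → InCoordSubspace D D' (gvec n D' δ) → IsAccordion n D δ
  subspace⇒accordion acc' g∈ s t s× t× =
    Chain-shortcut CrossedBy-mono CrossedBy? bypass (acc' s t (CrossedBy-mono s×) (CrossedBy-mono t×)) s× t×
    where
    bypass : ∀ {x} → CrossedBy n D' δ x → ¬ CrossedBy n D δ x → Bypassable (CrossedBy n D' δ) x
    bypass {u , v} (x∈ , x×δ) ¬x× with ∈-++⁻ D' x∈
    ... | inj₂ x∈B = ⊥-elim (¬x× (∈-++⁺ʳ D x∈B , x×δ))
    ... | inj₁ x∈D' = Fine.CrossedDiagonal.ζ≡0⇒bypassable p q δ-solid u v x∈D' x×δ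
                        (g∈ (u , v) x∈D' (λ x∈D → ¬x× (∈-++⁺ˡ x∈D , x×δ)))

  accordion⇒subspace : IsAccordion n D δ → InCoordSubspace D D' (gvec n D' δ)
  accordion⇒subspace acc (u , v) r∈D' r∉D with Cross? (u , v) δ
  ... | no ¬r× = ζ-¬Cross n D' u v δ ¬r×
  ... | yes r× = junction
    where
    open Fine.CrossedDiagonal p q δ-solid u v r∈D' r× using (SideA-exit; junction⇒ζ≡0; boundary≢r)
    r∉closure : ¬ (u , v) ∈ closure n D
    r∉closure r∈ with ∈-++⁻ D r∈
    ... | inj₁ r∈D = r∉D r∈D
    ... | inj₂ r∈B = boundary≢r r∈B refl
    junction : ζ n D' (u , v) δ ≡ + 0
    junction with SideA-exit (closure-mono ∘ proj₁) (accordion-connects-boundary {n} {D} acc)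
    ... | x , y , x× , y× , x-A , inj₁ y-B , x~y = junction⇒ζ≡0 (CrossedBy-mono x×) (CrossedBy-mono y×) x-A y-B x~y
    ... | _ , _ , _ , (r∈ , _) , _ , inj₂ refl , _ = ⊥-elim (r∉closure r∈)

  accordion⇒g-agree : IsAccordion n D' δ → IsAccordion n D δ → ∀ r → r ∈ D → gvec n D δ r ≡ gvec n D' δ r
  accordion⇒g-agree acc' acc (u , v) r∈D with Cross? (u , v) δ
  ... | no ¬r× = trans (ζ-¬Cross n D u v δ ¬r×) (sym (ζ-¬Cross n D' u v δ ¬r×))
  ... | yes r× = begin
    ζ n D (u , v) δ   ≡⟨ C.ζ≡sign ⟩
    sign C.C₁ C.C₂    ≡⟨ cong₂ sign (T-⇔⇒≡ C₁⇔) (T-⇔⇒≡ C₂⇔) ⟩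
    sign F.C₁ F.C₂    ≡⟨ sym F.ζ≡sign ⟩
    ζ n D' (u , v) δ  ∎
    where
    open ≡-Reasoning
    module C = Coarse.CrossedDiagonal p q δ-solid u v r∈D r×
    module F = Fine.CrossedDiagonal p q δ-solid u v (D⊆D' _ r∈D) r×
    Exit-mono : ∀ {K} → C.Exit K → F.Exit K
    Exit-mono (s , s× , k) = s , CrossedBy-mono s× , k
    -- Exits in D are exits in D', and D' has only one exit on each side.
    Exit-agree : ∀ {K L} → C.Exit K ⊎ C.Exit L → (F.Exit K → F.Exit L → ⊥) → C.Exit K ⇔ F.Exit K
    Exit-agree alt excl = mk⇔ Exit-mono (resolve-⊎ Exit-mono alt excl)
    C₁⇔ : T C.C₁ ⇔ T F.C₁
    C₁⇔ = ⇔-sym (F.T-C₁⇔Exits acc') ⇔-∘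
          ((Exit-agree (C.accordion⇒Exit-A acc) F.¬Exit-Au×Av ×-⇔
            Exit-agree (Sum.swap (C.accordion⇒Exit-B acc)) (flip F.¬Exit-Bu×Bv)) ⇔-∘
           C.T-C₁⇔Exits acc)
    C₂⇔ : T C.C₂ ⇔ T F.C₂
    C₂⇔ = ⇔-sym (F.T-C₂⇔Exits acc') ⇔-∘
          ((Exit-agree (Sum.swap (C.accordion⇒Exit-A acc)) (flip F.¬Exit-Au×Av) ×-⇔
            Exit-agree (C.accordion⇒Exit-B acc) F.¬Exit-Bu×Bv) ⇔-∘
           C.T-C₂⇔Exits acc)

lemma4p3 : (n : ℕ) → 2 ≤ n → (D D' : List Diag) →
    HollowDissection n D → HollowDissection n D' → D ⊆D D' →
    (δ : Diag) → SolidDiag n δ → IsAccordion n D' δ →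
    ((InCoordSubspace D D' (gvec n D' δ) → IsAccordion n D δ) ×
     (IsAccordion n D δ → InCoordSubspace D D' (gvec n D' δ))) ×
    (IsAccordion n D δ → ∀ r → r ∈ D → gvec n D δ r ≡ gvec n D' δ r)
lemma4p3 n 2≤n D D' D-diss D'-diss D⊆D' (p , q) δ-solid acc' =
  (subspace⇒accordion acc' , accordion⇒subspace) , accordion⇒g-agree acc'
  where open Refinement n 2≤n D D' D-diss D'-diss D⊆D' p q δ-solid
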